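{- Let $q$ be a prime power, let $\mathcal{P}$ be a subspace partition of $V=V(n,q)$ with dimensions $d_1<\cdots<d_m$, and let $ST$ be a $d$-supertail of $\mathcal{P}$ such that $t$ is the maximum dimension of a subspace in $ST$ and $d<2t$. For each hyperplane $H$ of $V$ let $\beta_H=\sum_{i=d_1}^{t} b_{H,i}\,q^{i}$, and let $\beta_0=\min_H\beta_H$ over all hyperplanes $H$ of $V$. If $|ST|=q^t+1$, then $\beta_0=q^t$. Moreover, there exists an integer $c_0$ such that \[\sum_{i=1}^{t} n_i\,\Theta_i=\frac{c_0q^{d}-1}{q-1}.\]
   Context: $V(n,q)$ denotes the $n$-dimensional vector space over the finite field with $q$ elements. A subspace partition of $V$ is a collection of nontrivial subspaces of $V$ such that every nonzero vector of $V$ lies in exactly one of them. For an integer $d$ with $d_1<d\le d_m$, the $d$-supertail of $\mathcal{P}$ is the set of subspaces in $\mathcal{P}$ of dimension less than $d$. $n_i$ denotes the number of $i$-dimensional subspaces in $\mathcal{P}$. For a hyperplane $H$ of $V$, $b_{H,x}$ denotes the number of $x$-dimensional subspaces of $\mathcal{P}$ contained in $H$. $\Theta_i=(q^i-1)/(q-1)$. -}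

module Defs where

open import Data.Nat as ℕ using (ℕ; zero; suc; _≤_; _<_; _∸_; _^_)
open import Data.Nat.ListAction using (sum)
open import Data.Bool.ListAction using (any)
open import Data.Bool using (Bool; true; false; _∧_; _∨_; if_then_else_)
open import Data.List using (List; []; _∷_; length; lookup)
import Data.List as List
open import Data.List.Membership.Propositional using (_∈_)
open import Data.List.Relation.Unary.Unique.Propositional using (Unique)
open import Data.Vec using (Vec; []; _∷_; zipWith; replicate)
open import Data.Fin using (Fin)
open import Data.Product using (Σ; ∃; _×_; _,_; proj₁)
open import Relation.Nullary using (¬_; does)
open import Relation.Binary.PropositionalEquality using (_≡_)
open import Relation.Binary.Definitions using (DecidableEquality)
open import Algebra.Structures using (IsCommutativeRing)
import Data.Vec.Properties as VecP

record FiniteField : Set₁ where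
  infixl 6 _+_
  infixl 7 _*_
  field
    Carrier     : Set
    _+_ _*_     : Carrier → Carrier → Carrier
    -_          : Carrier → Carrier
    0# 1#       : Carrier
    isCommutativeRing : IsCommutativeRing _≡_ _+_ _*_ -_ 0# 1#
    0≢1         : ¬ (0# ≡ 1#)
    inverse     : ∀ x → ¬ (x ≡ 0#) → ∃ λ y → x * y ≡ 1#
    _≟_         : DecidableEquality Carrier
    elements    : List Carrier
    complete    : ∀ x → x ∈ elements
    unique      : Unique elements

  order : ℕ
  order = length elements

module VectorSpace (F : FiniteField) (n : ℕ) where
  open FiniteField F

  V : Set
  V = Vec Carrier n

  zeroV : V
  zeroV = replicate n 0#

  lincomb : ∀ {k} → Vec Carrier k → Vec V k → V
  lincomb []       []       = zeroV
  lincomb (c ∷ cs) (b ∷ bs) = zipWith _+_ (Data.Vec.map (c *_) b) (lincomb cs bs)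

  LinIndep : ∀ {k} → Vec V k → Set
  LinIndep {k} B = ∀ (c : Vec Carrier k) → lincomb c B ≡ zeroV → c ≡ replicate k 0#

  record Subspace : Set where
    constructor subspace
    field
      dim     : ℕ
      basis   : Vec V dim
      indep   : LinIndep basis
  open Subspace public

  _∈S_ : V → Subspace → Set
  v ∈S S = ∃ λ (c : Vec Carrier (dim S)) → lincomb c (basis S) ≡ v

  _⊆S_ : Subspace → Subspace → Set
  S ⊆S T = ∀ v → v ∈S S → v ∈S T

  IsHyperplane : Subspace → Set
  IsHyperplane H = dim H ≡ n ∸ 1

  IsSubspacePartition : List Subspace → Set
  IsSubspacePartition P =
      (∀ (i : Fin (length P)) → 1 ≤ dim (lookup P i))
    × (∀ (v : V) → ¬ (v ≡ zeroV) → ∃ λ (i : Fin (length P)) → v ∈S lookup P i)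
    × (∀ (v : V) → ¬ (v ≡ zeroV) → ∀ (i j : Fin (length P)) →
         v ∈S lookup P i → v ∈S lookup P j → i ≡ j)

  -- decision of containment by exhaustive search over the finite field

  allVecs : (k : ℕ) → List (Vec Carrier k)
  allVecs zero    = [] ∷ []
  allVecs (suc k) = List.concatMap (λ x → List.map (x ∷_) (allVecs k)) elements

  _≟V_ : ∀ {m} → DecidableEquality (Vec Carrier m)
  _≟V_ = VecP.≡-dec _≟_

  memberᵇ : V → Subspace → Bool
  memberᵇ v S = any (λ c → does (lincomb c (basis S) ≟V v)) (allVecs (dim S))

  allVecᵇ : ∀ {k} → (V → Bool) → Vec V k → Bool
  allVecᵇ p []       = true
  allVecᵇ p (x ∷ xs) = p x ∧ allVecᵇ p xs

  containedᵇ : Subspace → Subspace → Bool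
  containedᵇ S T = allVecᵇ (λ v → memberᵇ v T) (basis S)

count : ∀ {A : Set} → (A → Bool) → List A → ℕ
count p []       = 0
count p (x ∷ xs) = (if p x then 1 else 0) ℕ.+ count p xs

-- Σ_{i=a}^{b} f i   (empty if b < a)
sumFromTo : ℕ → ℕ → (ℕ → ℕ) → ℕ
sumFromTo a b f = sum (List.map (λ j → f (a ℕ.+ j)) (List.upTo (suc b ∸ a)))

-- Θ_i = (q^i - 1)/(q - 1) = 1 + q + … + q^{i-1}
Θ : ℕ → ℕ → ℕ
Θ q i = sum (List.map (q ^_) (List.upTo i))

module Partition (F : FiniteField) (n : ℕ) (P : List (VectorSpace.Subspace F n)) where
  open FiniteField F using (order)
  open VectorSpace F n

  q : ℕ
  q = order

  nᵢ : ℕ → ℕ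
  nᵢ i = count (λ S → does (dim S ℕ.≟ i)) P

  -- |d-supertail| : number of members of P of dimension < d
  supertailSize : ℕ → ℕ
  supertailSize d = count (λ S → does (suc (dim S) ℕ.≤? d)) P

  b : Subspace → ℕ → ℕ
  b H x = count (λ S → does (dim S ℕ.≟ x) ∧ containedᵇ S H) P

  β : ℕ → ℕ → Subspace → ℕ
  β d₁ t H = sumFromTo d₁ t (λ i → b H i ℕ.* q ^ i)

module Submission where

-- Hyperplanes of V are the kernels a^⊥ of nonzero functionals v ↦ a·v, and a
-- member S lies in a^⊥ iff a annihilates a basis of S.  The rest is double
-- counting over the finite set F^n:
--   * |{c ∈ F^m : c·y = 0}| is q^m or q^(m-1), so the annihilator of k
--     independent vectors has q^(n-k) elements;
--   * counting a^⊥ through P gives Σ_{S ⊆ a^⊥} q^(dim S) = |P| - 1 for a ≠ 0;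
--     members outside ST have dimension ≥ d, so the tail weight
--     β(a) = Σ_{S ∈ ST, S ⊆ a^⊥} q^(dim S) is ≡ |P| - 1 (mod q^d) for all a ≠ 0;
--   * averaging β over all a ≠ 0 gives a₁ with β(a₁) ≤ q^t, and averaging over
--     the a ≠ 0 with S₀ ⊆ a^⊥ (S₀ ∈ ST of dimension t) gives a₂ with
--     q^t ≤ β(a₂) < q^d; the congruence forces β(a₁) = q^t ≤ β(a) for all a ≠ 0;
--   * the second claim is the congruence at a₁, combined with
--     Σ_S q^(dim S) + 1 = |P| + q^n and (q-1)Θ_i + 1 = q^i.

open import Defs
open import Data.Nat as ℕ using (ℕ; zero; suc; _+_; _*_; _∸_; _^_; _≤_; _<_; z≤n; s≤s; NonZero)
import Data.Nat.Properties as ℕP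
open import Data.Nat.DivMod using (_%_; [m+kn]%n≡m%n; m<n⇒m%n≡m; m%n≤m)
open import Data.Nat.ListAction using (sum)
open import Data.Nat.Tactic.RingSolver using (solve-∀)
open import Data.Integer as ℤ using (ℤ)
import Data.Integer.Properties as ℤP
import Data.Integer.Tactic.RingSolver as ℤSolver
open import Data.Bool using (Bool; true; false; if_then_else_; _∧_; not)
open import Data.Bool.ListAction using (any)
open import Data.List as List using (List; []; _∷_; _++_; map; concatMap; length; lookup)
import Data.List.Properties as ListP
open import Data.List.Membership.Propositional using (_∈_)
import Data.List.Membership.Propositional.Properties as ∈P
open import Data.List.Relation.Unary.All using (All; []; _∷_)
open import Data.List.Relation.Unary.AllPairs using (AllPairs; []; _∷_)
open import Data.List.Relation.Unary.Any using (here; there)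
import Data.List.Relation.Unary.Unique.Propositional.Properties as UniqueP
open import Data.Vec as Vec using (Vec; []; _∷_; zipWith; replicate)
import Data.Vec.Properties as VecP
open import Data.Fin as Fin using (Fin)
open import Data.Product using (Σ; ∃; _×_; _,_; proj₁; proj₂)
open import Data.Empty using (⊥; ⊥-elim)
open import Relation.Nullary using (¬_; Dec; yes; no; does)
open import Relation.Binary.Definitions using (DecidableEquality)
open import Relation.Binary.PropositionalEquality
open import Algebra.Bundles using (CommutativeRing)
import Algebra.Properties.Ring as RingProperties
import Algebra.Properties.CommutativeSemigroup as CommutativeSemigroupProperties
open import Level using (0ℓ)

private
  variable
    X Y : Set

𝟙 : Bool → ℕ
𝟙 b = if b then 1 else 0

𝟙≤1 : ∀ b → 𝟙 b ≤ 1
𝟙≤1 true  = ℕP.≤-refl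
𝟙≤1 false = z≤n

𝟙-∧ : ∀ a b → 𝟙 (a ∧ b) ≡ 𝟙 a * 𝟙 b
𝟙-∧ true  b = sym (ℕP.+-identityʳ (𝟙 b))
𝟙-∧ false b = refl

𝟙-idem : ∀ b → 𝟙 b * 𝟙 b ≡ 𝟙 b
𝟙-idem true  = refl
𝟙-idem false = refl

𝟙-injective : ∀ {a b} → 𝟙 a ≡ 𝟙 b → a ≡ b
𝟙-injective {true}  {true}  _ = refl
𝟙-injective {false} {false} _ = refl

does-yes : ∀ {P : Set} (d : Dec P) → P → does d ≡ true
does-yes (yes _) _ = refl
does-yes (no ¬p) p = ⊥-elim (¬p p)

does-no : ∀ {P : Set} (d : Dec P) → ¬ P → does d ≡ false
does-no (yes p) ¬p = ⊥-elim (¬p p)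
does-no (no _)  _  = refl

does-true : ∀ {P : Set} (d : Dec P) → does d ≡ true → P
does-true (yes p) _ = p

not-does : ∀ {P : Set} (d : Dec P) → not (does d) ≡ true → ¬ P
not-does (no ¬p) _ = ¬p

∧-true : ∀ x y → x ∧ y ≡ true → x ≡ true × y ≡ true
∧-true true true _ = refl , refl

𝟙-pos : ∀ {P : Set} (d : Dec P) → 0 < 𝟙 (does d) → P
𝟙-pos (yes p) _ = p

∑ : List X → (X → ℕ) → ℕ
∑ []       f = 0
∑ (x ∷ xs) f = f x + ∑ xs f

sum-map≡∑ : (g : X → ℕ) (xs : List X) → sum (map g xs) ≡ ∑ xs g
sum-map≡∑ g []       = refl
sum-map≡∑ g (x ∷ xs) = cong (g x +_) (sum-map≡∑ g xs)

module _ (xs : List X) where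

  ∑-cong : {f g : X → ℕ} → (∀ x → f x ≡ g x) → ∑ xs f ≡ ∑ xs g
  ∑-cong e = go xs
    where
      go : ∀ ys → ∑ ys _ ≡ ∑ ys _
      go []       = refl
      go (y ∷ ys) = cong₂ _+_ (e y) (go ys)

  ∑-+ : (f g : X → ℕ) → ∑ xs (λ x → f x + g x) ≡ ∑ xs f + ∑ xs g
  ∑-+ f g = go xs
    where
      go : ∀ ys → ∑ ys (λ x → f x + g x) ≡ ∑ ys f + ∑ ys g
      go []       = refl
      go (y ∷ ys) = trans (cong (f y + g y +_) (go ys)) (swap (f y) (g y) (∑ ys f) (∑ ys g))
        where
          swap : ∀ a b c d → a + b + (c + d) ≡ a + c + (b + d)
          swap = solve-∀

  ∑-*ˡ : (c : ℕ) (f : X → ℕ) → ∑ xs (λ x → c * f x) ≡ c * ∑ xs f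
  ∑-*ˡ c f = go xs
    where
      go : ∀ ys → ∑ ys (λ x → c * f x) ≡ c * ∑ ys f
      go []       = sym (ℕP.*-zeroʳ c)
      go (y ∷ ys) = trans (cong (c * f y +_) (go ys)) (sym (ℕP.*-distribˡ-+ c (f y) _))

  ∑-*ʳ : (c : ℕ) (f : X → ℕ) → ∑ xs (λ x → f x * c) ≡ ∑ xs f * c
  ∑-*ʳ c f = trans (∑-cong (λ x → ℕP.*-comm (f x) c)) (trans (∑-*ˡ c f) (ℕP.*-comm c _))

  ∑-const : (c : ℕ) → ∑ xs (λ _ → c) ≡ length xs * c
  ∑-const c = go xs
    where
      go : ∀ ys → ∑ ys (λ _ → c) ≡ length ys * c
      go []       = refl
      go (y ∷ ys) = cong (c +_) (go ys)

  ∑-mono : {f g : X → ℕ} → (∀ x → f x ≤ g x) → ∑ xs f ≤ ∑ xs g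
  ∑-mono le = go xs
    where
      go : ∀ ys → ∑ ys _ ≤ ∑ ys _
      go []       = z≤n
      go (y ∷ ys) = ℕP.+-mono-≤ (le y) (go ys)

  ∑-zero : (f : X → ℕ) → (∀ x → f x ≡ 0) → ∑ xs f ≡ 0
  ∑-zero f z = ℕP.n≤0⇒n≡0 (subst (∑ xs f ≤_) (lemma xs) (∑-mono (λ x → ℕP.≤-reflexive (z x))))
    where
      lemma : ∀ ys → ∑ ys (λ _ → 0) ≡ 0
      lemma []       = refl
      lemma (_ ∷ ys) = lemma ys

  ∑-pos : (f : X → ℕ) → 0 < ∑ xs f → ∃ λ x → 0 < f x
  ∑-pos f = go xs
    where
      go : ∀ ys → 0 < ∑ ys f → ∃ λ x → 0 < f x
      go (y ∷ ys) p with f y in eq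
      ... | zero  = go ys p
      ... | suc _ = y , subst (0 <_) (sym eq) (s≤s z≤n)

∑-witness : (xs : List X) (p : X → Bool) → 0 < ∑ xs (λ x → 𝟙 (p x)) → ∃ λ x → p x ≡ true
∑-witness xs p pos with ∑-pos xs _ pos
... | x , px with p x in eq
...   | true  = x , eq
...   | false = ⊥-elim (ℕP.n≮0 px)

∑-<-witness : (xs : List X) (h g : X → ℕ) → ∑ xs h < ∑ xs g → ∃ λ x → h x < g x
∑-<-witness (x ∷ xs) h g lt with h x ℕ.<? g x
... | yes hx<gx = x , hx<gx
... | no hx≮gx  = ∑-<-witness xs h g (ℕP.+-cancelˡ-< (g x) _ _
                    (ℕP.≤-<-trans (ℕP.+-monoˡ-≤ (∑ xs h) (ℕP.≮⇒≥ hx≮gx)) lt))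

𝟙-*-< : ∀ b y z → 𝟙 b * y < 𝟙 b * z → b ≡ true × y < z
𝟙-*-< true  y z lt = refl , subst₂ _<_ (ℕP.+-identityʳ y) (ℕP.+-identityʳ z) lt
𝟙-*-< false y z ()

any≡∑ : (p : X → Bool) (xs : List X) → ∑ xs (λ x → 𝟙 (p x)) ≤ 1 → 𝟙 (any p xs) ≡ ∑ xs (λ x → 𝟙 (p x))
any≡∑ p []       _ = refl
any≡∑ p (x ∷ xs) le with p x
... | true  = sym (cong suc (ℕP.n≤0⇒n≡0 (ℕP.≤-pred le)))
... | false = any≡∑ p xs le

∑-++ : (xs ys : List X) (f : X → ℕ) → ∑ (xs ++ ys) f ≡ ∑ xs f + ∑ ys f
∑-++ []       ys f = refl
∑-++ (x ∷ xs) ys f = trans (cong (f x +_) (∑-++ xs ys f)) (sym (ℕP.+-assoc (f x) _ _))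

∑-map : (h : X → Y) (xs : List X) (f : Y → ℕ) → ∑ (map h xs) f ≡ ∑ xs (λ x → f (h x))
∑-map h []       f = refl
∑-map h (x ∷ xs) f = cong (f (h x) +_) (∑-map h xs f)

∑-concatMap : (h : X → List Y) (xs : List X) (f : Y → ℕ) →
  ∑ (concatMap h xs) f ≡ ∑ xs (λ x → ∑ (h x) f)
∑-concatMap h []       f = refl
∑-concatMap h (x ∷ xs) f = trans (∑-++ (h x) (concatMap h xs) f) (cong (∑ (h x) f +_) (∑-concatMap h xs f))

∑-swap : (xs : List X) (ys : List Y) (f : X → Y → ℕ) →
  ∑ xs (λ x → ∑ ys (f x)) ≡ ∑ ys (λ y → ∑ xs (λ x → f x y))
∑-swap []       ys f = sym (∑-zero ys _ (λ _ → refl))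
∑-swap (x ∷ xs) ys f = trans (cong (∑ ys (f x) +_) (∑-swap xs ys f))
                             (sym (∑-+ ys (f x) (λ y → ∑ xs (λ x → f x y))))

∑-tabulate : ∀ {M} (f : Fin M → X) (g : X → ℕ) → ∑ (List.tabulate f) g ≡ ∑ (List.allFin M) (λ i → g (f i))
∑-tabulate {M = zero}  f g = refl
∑-tabulate {M = suc M} f g = cong (g (f Fin.zero) +_)
  (trans (∑-tabulate (λ i → f (Fin.suc i)) g) (sym (∑-tabulate Fin.suc (λ i → g (f i)))))

∑-applyUpTo : ∀ (f g : ℕ → ℕ) L → ∑ (List.applyUpTo f L) g ≡ ∑ (List.upTo L) (λ j → g (f j))
∑-applyUpTo f g zero    = refl
∑-applyUpTo f g (suc L) = cong (g (f 0) +_) (trans (∑-applyUpTo (λ j → f (suc j)) g L) (sym (∑-applyUpTo suc (λ j → g (f j)) L)))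

∑-upTo-δ : ∀ L x → ∑ (List.upTo L) (λ j → 𝟙 (does (x ℕ.≟ j))) ≡ 𝟙 (does (x ℕ.<? L))
∑-upTo-δ zero    x       = refl
∑-upTo-δ (suc L) zero    = cong suc (trans (∑-applyUpTo suc _ L) (∑-zero (List.upTo L) _ (λ j → refl)))
∑-upTo-δ (suc L) (suc x) = trans (∑-applyUpTo suc _ L) (∑-upTo-δ L x)

∑-upTo-shift : ∀ o x → o ≤ x → ∀ L → ∑ (List.upTo L) (λ j → 𝟙 (does (x ℕ.≟ o + j))) ≡ 𝟙 (does ((x ∸ o) ℕ.<? L))
∑-upTo-shift o x o≤x L = trans (∑-cong (List.upTo L) (λ j → cong 𝟙 (shift j))) (∑-upTo-δ L (x ∸ o))
  where
    shift : ∀ j → does (x ℕ.≟ o + j) ≡ does ((x ∸ o) ℕ.≟ j)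
    shift j with (x ∸ o) ℕ.≟ j
    ... | yes refl = trans (does-yes (x ℕ.≟ o + (x ∸ o)) (sym (ℕP.m+[n∸m]≡n o≤x))) (sym (does-yes ((x ∸ o) ℕ.≟ (x ∸ o)) refl))
    ... | no ne    = trans (does-no (x ℕ.≟ o + j) (λ e → ne (trans (cong (_∸ o) e) (ℕP.m+n∸m≡n o j)))) (sym (does-no ((x ∸ o) ℕ.≟ j) ne))

record Enumeration (X : Set) : Set where
  field
    list : List X
    _≟_  : DecidableEquality X
    once : ∀ y → ∑ list (λ x → 𝟙 (does (x ≟ y))) ≡ 1

module EnumerationProperties {X : Set} (E : Enumeration X) where
  open Enumeration E

  delta : (y : X) (g : X → ℕ) → ∑ list (λ x → 𝟙 (does (x ≟ y)) * g x) ≡ g y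
  delta y g = begin
      ∑ list (λ x → 𝟙 (does (x ≟ y)) * g x) ≡⟨ ∑-cong list move ⟩
      ∑ list (λ x → 𝟙 (does (x ≟ y)) * g y) ≡⟨ ∑-*ʳ list (g y) _ ⟩
      ∑ list (λ x → 𝟙 (does (x ≟ y))) * g y ≡⟨ cong (_* g y) (once y) ⟩
      1 * g y                                ≡⟨ ℕP.*-identityˡ (g y) ⟩
      g y                                    ∎
    where
      open ≡-Reasoning
      move : ∀ x → 𝟙 (does (x ≟ y)) * g x ≡ 𝟙 (does (x ≟ y)) * g y
      move x with x ≟ y
      ... | yes refl = refl
      ... | no _     = refl

  split : (y : X) (g : X → ℕ) → ∑ list g ≡ g y + ∑ list (λ x → 𝟙 (not (does (x ≟ y))) * g x)
  split y g = trans (∑-cong list cases) (trans (∑-+ list _ _) (cong (_+ rest) (delta y g)))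
    where
      rest : ℕ
      rest = ∑ list (λ x → 𝟙 (not (does (x ≟ y))) * g x)
      cases : ∀ x → g x ≡ 𝟙 (does (x ≟ y)) * g x + 𝟙 (not (does (x ≟ y))) * g x
      cases x with does (x ≟ y)
      ... | true  = sym (trans (ℕP.+-identityʳ (1 * g x)) (ℕP.*-identityˡ (g x)))
      ... | false = sym (ℕP.+-identityʳ (g x))

  term≤∑ : (g : X → ℕ) (y : X) → g y ≤ ∑ list g
  term≤∑ g y = subst (_≤ ∑ list g) (delta y g) (∑-mono list bound)
    where
      bound : ∀ x → 𝟙 (does (x ≟ y)) * g x ≤ g x
      bound x with does (x ≟ y)
      ... | true  = ℕP.≤-reflexive (ℕP.+-identityʳ (g x))
      ... | false = z≤n

  ∑-≤-≡ : (h g : X → ℕ) → (∀ x → h x ≤ g x) → ∑ list h ≡ ∑ list g → ∀ y → h y ≡ g y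
  ∑-≤-≡ h g le e y =
    ℕP.≤-antisym (le y) (ℕP.m∸n≡0⇒m≤n (ℕP.n≤0⇒n≡0 (subst (g y ∸ h y ≤_) gap≡0 (term≤∑ (λ x → g x ∸ h x) y))))
    where
      gap≡0 : ∑ list (λ x → g x ∸ h x) ≡ 0
      gap≡0 = ℕP.+-cancelˡ-≡ (∑ list h) _ _ (begin
          ∑ list h + ∑ list (λ x → g x ∸ h x) ≡⟨ sym (∑-+ list h _) ⟩
          ∑ list (λ x → h x + (g x ∸ h x))    ≡⟨ ∑-cong list (λ x → ℕP.m+[n∸m]≡n (le x)) ⟩
          ∑ list g                             ≡⟨ sym e ⟩
          ∑ list h                             ≡⟨ sym (ℕP.+-identityʳ _) ⟩
          ∑ list h + 0                         ∎)
        where open ≡-Reasoning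

unique-once : (_≟_ : DecidableEquality X) (xs : List X) → AllPairs (λ x y → ¬ x ≡ y) xs →
  ∀ y → y ∈ xs → ∑ xs (λ x → 𝟙 (does (x ≟ y))) ≡ 1
unique-once _≟_ (x ∷ xs) (x∉xs ∷ _) y (here refl) with y ≟ y
... | no y≢y = ⊥-elim (y≢y refl)
... | yes _  = cong suc (absent xs x∉xs)
  where
    absent : ∀ zs → All (λ z → ¬ y ≡ z) zs → ∑ zs (λ x → 𝟙 (does (x ≟ y))) ≡ 0
    absent []       []         = refl
    absent (z ∷ zs) (y≢z ∷ ns) with z ≟ y
    ... | yes z≡y = ⊥-elim (y≢z (sym z≡y))
    ... | no _    = absent zs ns
unique-once _≟_ (x ∷ xs) (x∉xs ∷ u) y (there y∈xs) with x ≟ y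
... | yes refl = ⊥-elim (distinct x∉xs y∈xs)
  where
    distinct : ∀ {zs} → All (λ z → ¬ x ≡ z) zs → x ∈ zs → ⊥
    distinct (n ∷ ns) (here e)  = n e
    distinct (n ∷ ns) (there m) = distinct ns m
... | no _ = unique-once _≟_ xs u y y∈xs

finEnumeration : ∀ N → Enumeration (Fin N)
finEnumeration N = record
  { list = List.allFin N
  ; _≟_  = Fin._≟_
  ; once = λ y → unique-once Fin._≟_ (List.allFin N) (UniqueP.allFin⁺ N) y (∈P.∈-allFin y)
  }

module FieldVectors (F : FiniteField) where
  open FiniteField F using (Carrier; 0#; 1#; -_; 0≢1; inverse; elements; complete; unique; order)
    renaming (_+_ to _+F_; _*_ to _*F_; _≟_ to _≟F_)

  ring : CommutativeRing 0ℓ 0ℓ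
  ring = record
    { Carrier = Carrier ; _≈_ = _≡_ ; _+_ = _+F_ ; _*_ = _*F_ ; -_ = -_ ; 0# = 0# ; 1# = 1#
    ; isCommutativeRing = FiniteField.isCommutativeRing F }

  open CommutativeRing ring public
    using (+-assoc; +-comm; +-identityˡ; +-identityʳ; -‿inverseˡ; -‿inverseʳ; *-assoc; *-comm;
           *-identityˡ; *-identityʳ; zeroˡ; zeroʳ; distribˡ; distribʳ)
  open RingProperties (CommutativeRing.ring ring)
    using (-1*x≈-x; +-inverseʳ-unique; x∙y⁻¹≈ε⇒x≈y; -‿involutive)
  open CommutativeSemigroupProperties (CommutativeRing.+-commutativeSemigroup ring)
    renaming (interchange to +-interchange) using ()
  open CommutativeSemigroupProperties (CommutativeRing.*-commutativeSemigroup ring)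
    renaming (interchange to *-interchange) using ()

  q : ℕ
  q = order

  inv : ∀ x → ¬ x ≡ 0# → Carrier
  inv x x≢0 = proj₁ (inverse x x≢0)

  inv-l : ∀ x (x≢0 : ¬ x ≡ 0#) → inv x x≢0 *F x ≡ 1#
  inv-l x x≢0 = trans (*-comm _ x) (proj₂ (inverse x x≢0))

  affineRoot : ∀ β → ¬ β ≡ 0# → Carrier → Carrier
  affineRoot β β≢0 c = (- c) *F inv β β≢0

  affineRoot-root : ∀ β (β≢0 : ¬ β ≡ 0#) c → affineRoot β β≢0 c *F β +F c ≡ 0#
  affineRoot-root β β≢0 c = begin
      (- c) *F inv β β≢0 *F β +F c   ≡⟨ cong (_+F c) (*-assoc (- c) _ β) ⟩
      (- c) *F (inv β β≢0 *F β) +F c ≡⟨ cong (λ z → (- c) *F z +F c) (inv-l β β≢0) ⟩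
      (- c) *F 1# +F c               ≡⟨ cong (_+F c) (*-identityʳ (- c)) ⟩
      - c +F c                       ≡⟨ -‿inverseˡ c ⟩
      0#                             ∎
    where open ≡-Reasoning

  affineRoot-unique : ∀ β (β≢0 : ¬ β ≡ 0#) c x → x *F β +F c ≡ 0# → x ≡ affineRoot β β≢0 c
  affineRoot-unique β β≢0 c x e = begin
      x                               ≡⟨ sym (*-identityʳ x) ⟩
      x *F 1#                         ≡⟨ cong (x *F_) (sym (proj₂ (inverse β β≢0))) ⟩
      x *F (β *F inv β β≢0)           ≡⟨ sym (*-assoc x β _) ⟩
      x *F β *F inv β β≢0             ≡⟨ cong (_*F inv β β≢0) xβ≡-c ⟩
      (- c) *F inv β β≢0              ∎
    where
      open ≡-Reasoning
      xβ≡-c : x *F β ≡ - c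
      xβ≡-c = +-inverseʳ-unique c (x *F β) (trans (+-comm c _) e)

  -inv*-x : ∀ x (x≢0 : ¬ x ≡ 0#) → ((- 1#) *F inv x x≢0) *F ((- 1#) *F x) ≡ 1#
  -inv*-x x x≢0 = begin
      ((- 1#) *F inv x x≢0) *F ((- 1#) *F x) ≡⟨ *-interchange (- 1#) _ (- 1#) x ⟩
      ((- 1#) *F (- 1#)) *F (inv x x≢0 *F x) ≡⟨ cong₂ _*F_ -1*-1 (inv-l x x≢0) ⟩
      1# *F 1#                               ≡⟨ *-identityˡ 1# ⟩
      1#                                     ∎
    where
      open ≡-Reasoning
      -1*-1 : (- 1#) *F (- 1#) ≡ 1#
      -1*-1 = trans (-1*x≈-x (- 1#)) (-‿involutive 1#)

  Vc : ℕ → Set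
  Vc m = Vec Carrier m

  0v : ∀ {m} → Vc m
  0v {m} = replicate m 0#

  infixl 6 _⊕_
  infixr 7 _•_

  _⊕_ : ∀ {m} → Vc m → Vc m → Vc m
  _⊕_ = zipWith _+F_

  ⊖_ : ∀ {m} → Vc m → Vc m
  ⊖_ = Vec.map -_

  _•_ : ∀ {m} → Carrier → Vc m → Vc m
  c • u = Vec.map (c *F_) u

  dot : ∀ {m} → Vc m → Vc m → Carrier
  dot []       []       = 0#
  dot (x ∷ xs) (y ∷ ys) = x *F y +F dot xs ys

  _≟v_ : ∀ {m} → DecidableEquality (Vc m)
  _≟v_ = VecP.≡-dec _≟F_

  ⊕-assoc : ∀ {m} (u v w : Vc m) → u ⊕ v ⊕ w ≡ u ⊕ (v ⊕ w)
  ⊕-assoc = VecP.zipWith-assoc +-assoc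

  ⊕-identityˡ : ∀ {m} (u : Vc m) → 0v ⊕ u ≡ u
  ⊕-identityˡ = VecP.zipWith-identityˡ +-identityˡ

  ⊕-identityʳ : ∀ {m} (u : Vc m) → u ⊕ 0v ≡ u
  ⊕-identityʳ = VecP.zipWith-identityʳ +-identityʳ

  ⊕-inverseʳ : ∀ {m} (u : Vc m) → u ⊕ ⊖ u ≡ 0v
  ⊕-inverseʳ = VecP.zipWith-inverseʳ -‿inverseʳ

  ⊕-interchange : ∀ {m} (a b c d : Vc m) → (a ⊕ b) ⊕ (c ⊕ d) ≡ (a ⊕ c) ⊕ (b ⊕ d)
  ⊕-interchange []       []       []       []       = refl
  ⊕-interchange (a ∷ as) (b ∷ bs) (c ∷ cs) (d ∷ ds) = cong₂ _∷_ (+-interchange a b c d) (⊕-interchange as bs cs ds)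

  ⊕≡0⇒≡⊖ : ∀ {m} (u v : Vc m) → u ⊕ v ≡ 0v → v ≡ ⊖ u
  ⊕≡0⇒≡⊖ []      []      e = refl
  ⊕≡0⇒≡⊖ (x ∷ u) (y ∷ v) e = cong₂ _∷_ (+-inverseʳ-unique x y (VecP.∷-injectiveˡ e)) (⊕≡0⇒≡⊖ u v (VecP.∷-injectiveʳ e))

  ⊕⊖≡0⇒≡ : ∀ {m} (u v : Vc m) → u ⊕ ⊖ v ≡ 0v → u ≡ v
  ⊕⊖≡0⇒≡ []      []      e = refl
  ⊕⊖≡0⇒≡ (x ∷ u) (y ∷ v) e = cong₂ _∷_ (x∙y⁻¹≈ε⇒x≈y x y (VecP.∷-injectiveˡ e)) (⊕⊖≡0⇒≡ u v (VecP.∷-injectiveʳ e))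

  •-zeroˡ : ∀ {m} (u : Vc m) → 0# • u ≡ 0v
  •-zeroˡ []      = refl
  •-zeroˡ (x ∷ u) = cong₂ _∷_ (zeroˡ x) (•-zeroˡ u)

  •-zeroʳ : ∀ {m} c → c • 0v {m} ≡ 0v
  •-zeroʳ {zero}  c = refl
  •-zeroʳ {suc m} c = cong₂ _∷_ (zeroʳ c) (•-zeroʳ c)

  •-identity : ∀ {m} (u : Vc m) → 1# • u ≡ u
  •-identity u = trans (VecP.map-cong *-identityˡ u) (VecP.map-id u)

  •-assoc : ∀ {m} a b (u : Vc m) → a • b • u ≡ (a *F b) • u
  •-assoc a b u = trans (sym (VecP.map-∘ (a *F_) (b *F_) u))
                        (VecP.map-cong (λ x → sym (*-assoc a b x)) u)

  •-distribˡ : ∀ {m} a (u v : Vc m) → a • (u ⊕ v) ≡ a • u ⊕ a • v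
  •-distribˡ a []      []      = refl
  •-distribˡ a (x ∷ u) (y ∷ v) = cong₂ _∷_ (distribˡ a x y) (•-distribˡ a u v)

  •-distribʳ : ∀ {m} a b (u : Vc m) → (a +F b) • u ≡ a • u ⊕ b • u
  •-distribʳ a b []      = refl
  •-distribʳ a b (x ∷ u) = cong₂ _∷_ (distribʳ x a b) (•-distribʳ a b u)

  -1• : ∀ {m} (u : Vc m) → (- 1#) • u ≡ ⊖ u
  -1• = VecP.map-cong -1*x≈-x

  dot-zeroˡ : ∀ {m} (u : Vc m) → dot 0v u ≡ 0#
  dot-zeroˡ []      = refl
  dot-zeroˡ (x ∷ u) = trans (cong₂ _+F_ (zeroˡ x) (dot-zeroˡ u)) (+-identityˡ 0#)

  dot-zeroʳ : ∀ {m} (u : Vc m) → dot u 0v ≡ 0#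
  dot-zeroʳ []      = refl
  dot-zeroʳ (x ∷ u) = trans (cong₂ _+F_ (zeroʳ x) (dot-zeroʳ u)) (+-identityˡ 0#)

  dot-comm : ∀ {m} (u v : Vc m) → dot u v ≡ dot v u
  dot-comm []      []      = refl
  dot-comm (x ∷ u) (y ∷ v) = cong₂ _+F_ (*-comm x y) (dot-comm u v)

  dot-⊕ʳ : ∀ {m} (a u v : Vc m) → dot a (u ⊕ v) ≡ dot a u +F dot a v
  dot-⊕ʳ []      []      []      = sym (+-identityˡ 0#)
  dot-⊕ʳ (x ∷ a) (y ∷ u) (z ∷ v) = trans (cong₂ _+F_ (distribˡ x y z) (dot-⊕ʳ a u v)) (+-interchange _ _ _ _)

  dot-•ʳ : ∀ {m} (a : Vc m) c (u : Vc m) → dot a (c • u) ≡ c *F dot a u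
  dot-•ʳ []      c []      = sym (zeroʳ c)
  dot-•ʳ (x ∷ a) c (y ∷ u) = trans (cong₂ _+F_ (*-leftComm x c y) (dot-•ʳ a c u)) (sym (distribˡ c _ _))
    where
      *-leftComm : ∀ x c y → x *F (c *F y) ≡ c *F (x *F y)
      *-leftComm x c y = trans (sym (*-assoc x c y))
        (trans (cong (_*F y) (*-comm x c)) (*-assoc c x y))

  allV : (m : ℕ) → List (Vc m)
  allV zero    = [] ∷ []
  allV (suc m) = concatMap (λ x → map (x ∷_) (allV m)) elements

  ∑V : (m : ℕ) → (Vc m → ℕ) → ℕ
  ∑V m f = ∑ (allV m) f

  ∑V-suc : ∀ m (f : Vc (suc m) → ℕ) → ∑V (suc m) f ≡ ∑ elements (λ x → ∑V m (λ v → f (x ∷ v)))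
  ∑V-suc m f = trans (∑-concatMap _ elements f) (∑-cong elements (λ x → ∑-map (x ∷_) (allV m) f))

  fieldEnumeration : Enumeration Carrier
  fieldEnumeration = record
    { list = elements ; _≟_ = _≟F_ ; once = λ y → unique-once _≟F_ elements unique y (complete y) }

  allV-once : ∀ m (y : Vc m) → ∑V m (λ x → 𝟙 (does (x ≟v y))) ≡ 1
  allV-once zero    []      = refl
  allV-once (suc m) (y ∷ w) = begin
      ∑V (suc m) (λ x → 𝟙 (does (x ≟v (y ∷ w))))
        ≡⟨ ∑V-suc m _ ⟩
      ∑ elements (λ x → ∑V m (λ v → 𝟙 (does (x ≟F y) ∧ does (v ≟v w))))
        ≡⟨ ∑-cong elements (λ x → ∑-cong (allV m) (λ v → 𝟙-∧ (does (x ≟F y)) (does (v ≟v w)))) ⟩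
      ∑ elements (λ x → ∑V m (λ v → 𝟙 (does (x ≟F y)) * 𝟙 (does (v ≟v w))))
        ≡⟨ ∑-cong elements (λ x → ∑-*ˡ (allV m) (𝟙 (does (x ≟F y))) _) ⟩
      ∑ elements (λ x → 𝟙 (does (x ≟F y)) * ∑V m (λ v → 𝟙 (does (v ≟v w))))
        ≡⟨ ∑-cong elements (λ x → cong (𝟙 (does (x ≟F y)) *_) (allV-once m w)) ⟩
      ∑ elements (λ x → 𝟙 (does (x ≟F y)) * 1)
        ≡⟨ EnumerationProperties.delta fieldEnumeration y (λ _ → 1) ⟩
      1 ∎
    where open ≡-Reasoning

  vecEnumeration : (m : ℕ) → Enumeration (Vc m)
  vecEnumeration m = record { list = allV m ; _≟_ = _≟v_ ; once = allV-once m }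

  ∑V-const : ∀ m c → ∑V m (λ _ → c) ≡ q ^ m * c
  ∑V-const zero    c = refl
  ∑V-const (suc m) c = begin
      ∑V (suc m) (λ _ → c)              ≡⟨ ∑V-suc m _ ⟩
      ∑ elements (λ _ → ∑V m (λ _ → c)) ≡⟨ ∑-cong elements (λ _ → ∑V-const m c) ⟩
      ∑ elements (λ _ → q ^ m * c)      ≡⟨ ∑-const elements _ ⟩
      q * (q ^ m * c)                   ≡⟨ sym (ℕP.*-assoc q (q ^ m) c) ⟩
      q ^ suc m * c                     ∎
    where open ≡-Reasoning

  ∑V-1 : ∀ m → ∑V m (λ _ → 1) ≡ q ^ m
  ∑V-1 m = trans (∑V-const m 1) (ℕP.*-identityʳ (q ^ m))

  -- 0 and 1 are distinct elements, so q ≥ 2; we write q = 1 + q'.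
  q≥2 : 2 ≤ q
  q≥2 = subst (2 ≤_) (trans (∑-const elements 1) (ℕP.*-identityʳ q))
                     (subst (_≤ ∑ elements (λ _ → 1)) two (∑-mono elements atMostOne))
    where
      open EnumerationProperties fieldEnumeration using (delta)
      is0or1 : Carrier → ℕ
      is0or1 x = 𝟙 (does (x ≟F 0#)) * 1 + 𝟙 (does (x ≟F 1#)) * 1
      two : ∑ elements is0or1 ≡ 2
      two = trans (∑-+ elements _ _) (cong₂ _+_ (delta 0# (λ _ → 1)) (delta 1# (λ _ → 1)))
      atMostOne : ∀ x → is0or1 x ≤ 1
      atMostOne x with x ≟F 0# | x ≟F 1#
      ... | yes x≡0 | yes x≡1 = ⊥-elim (0≢1 (trans (sym x≡0) x≡1))
      ... | yes _   | no _    = ℕP.≤-refl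
      ... | no _    | yes _   = ℕP.≤-refl
      ... | no _    | no _    = z≤n

  q' : ℕ
  q' = q ∸ 1

  q≡1+q' : q ≡ suc q'
  q≡1+q' = sym (ℕP.m+[n∸m]≡n (ℕP.≤-trans (s≤s z≤n) q≥2))

  1≤q' : 1 ≤ q'
  1≤q' = ℕP.∸-monoˡ-≤ 1 q≥2

  instance
    q≢0 : NonZero q
    q≢0 = ℕ.>-nonZero (ℕP.≤-trans (s≤s z≤n) q≥2)

  q^≢0 : ∀ m → NonZero (q ^ m)
  q^≢0 m = ℕ.>-nonZero (ℕP.m^n>0 q m)

  ^-cancel-≤ : ∀ a b → q ^ a ≤ q ^ b → a ≤ b
  ^-cancel-≤ a b le with a ℕ.≤? b
  ... | yes a≤b = a≤b
  ... | no a≰b  = ⊥-elim (ℕP.<-irrefl refl (ℕP.≤-<-trans le (ℕP.^-monoʳ-< q q≥2 (ℕP.≰⇒> a≰b))))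

-- The number of solutions c ∈ F^m of one linear equation c·y = 0 is q^(m-1)
-- when y ≠ 0 and q^m when y = 0.
module LinearEquation (F : FiniteField) where
  open FiniteField F using (0#; elements) renaming (_+_ to _+F_; _*_ to _*F_; _≟_ to _≟F_)
  open FieldVectors F

  kerSize : ∀ m → Vc m → ℕ
  kerSize m y = ∑V m (λ c → 𝟙 (does (dot c y ≟F 0#)))

  -- a zero coordinate of y leaves the first coordinate of c free
  kerSize-cons-zero : ∀ m (y : Vc m) → kerSize (suc m) (0# ∷ y) ≡ q * kerSize m y
  kerSize-cons-zero m y = begin
      kerSize (suc m) (0# ∷ y)
        ≡⟨ ∑V-suc m _ ⟩
      ∑ elements (λ x → ∑V m (λ c → 𝟙 (does ((x *F 0# +F dot c y) ≟F 0#))))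
        ≡⟨ ∑-cong elements (λ x → ∑-cong (allV m) (λ c → cong (λ z → 𝟙 (does (z ≟F 0#))) (x0+d≡d x c))) ⟩
      ∑ elements (λ _ → kerSize m y)
        ≡⟨ ∑-const elements _ ⟩
      q * kerSize m y ∎
    where
      open ≡-Reasoning
      x0+d≡d : ∀ x c → x *F 0# +F dot c y ≡ dot c y
      x0+d≡d x c = trans (cong (_+F dot c y) (zeroʳ x)) (+-identityˡ _)

  -- a nonzero coordinate β of y determines the first coordinate of c
  kerSize-cons-nonzero : ∀ m β (y : Vc m) → ¬ β ≡ 0# → kerSize (suc m) (β ∷ y) ≡ q ^ m
  kerSize-cons-nonzero m β y β≢0 = begin
      kerSize (suc m) (β ∷ y)
        ≡⟨ ∑V-suc m _ ⟩
      ∑ elements (λ x → ∑V m (λ c → 𝟙 (does ((x *F β +F dot c y) ≟F 0#))))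
        ≡⟨ ∑-swap elements (allV m) _ ⟩
      ∑V m (λ c → ∑ elements (λ x → 𝟙 (does ((x *F β +F dot c y) ≟F 0#))))
        ≡⟨ ∑-cong (allV m) (λ c → trans (∑-cong elements (λ x → cong 𝟙 (root-test (dot c y) x)))
                                         (Enumeration.once fieldEnumeration _)) ⟩
      ∑V m (λ _ → 1)
        ≡⟨ ∑V-1 m ⟩
      q ^ m ∎
    where
      open ≡-Reasoning
      root-test : ∀ d x → does ((x *F β +F d) ≟F 0#) ≡ does (x ≟F affineRoot β β≢0 d)
      root-test d x with x ≟F affineRoot β β≢0 d
      ... | yes refl = does-yes (_ ≟F 0#) (affineRoot-root β β≢0 d)
      ... | no x≢r   = does-no (_ ≟F 0#) (λ e → x≢r (affineRoot-unique β β≢0 d x e))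

  kerSize-count : ∀ m (y : Vc m) → q * kerSize m y ≡ q ^ m + 𝟙 (does (y ≟v 0v)) * (q' * q ^ m)
  kerSize-count zero [] rewrite does-yes (0# ≟F 0#) refl | q≡1+q' = base-case q'
    where
      base-case : ∀ Q → suc Q * (1 + 0) ≡ 1 + 1 * (Q * 1)
      base-case = solve-∀
  kerSize-count (suc m) (β ∷ y) with β ≟F 0#
  ... | yes refl = begin
      q * kerSize (suc m) (0# ∷ y)                              ≡⟨ cong (q *_) (kerSize-cons-zero m y) ⟩
      q * (q * kerSize m y)                                     ≡⟨ cong (q *_) (kerSize-count m y) ⟩
      q * (q ^ m + 𝟙 (does (y ≟v 0v)) * (q' * q ^ m))           ≡⟨ distribute q (q ^ m) (𝟙 (does (y ≟v 0v))) q' ⟩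
      q ^ suc m + 𝟙 (does (y ≟v 0v)) * (q' * q ^ suc m)         ∎
    where
      open ≡-Reasoning
      distribute : ∀ Q a i Q' → Q * (a + i * (Q' * a)) ≡ Q * a + i * (Q' * (Q * a))
      distribute = solve-∀
  ... | no β≢0 = trans (cong (q *_) (kerSize-cons-nonzero m β y β≢0)) (sym (ℕP.+-identityʳ _))

module Spans (F : FiniteField) (n : ℕ) where
  open FiniteField F using (0#; 1#; -_) renaming (_+_ to _+F_; _≟_ to _≟F_)
  open FieldVectors F
  open LinearEquation F
  open VectorSpace F n

  lincomb-zero : ∀ {k} (B : Vec V k) → lincomb 0v B ≡ 0v
  lincomb-zero []      = refl
  lincomb-zero (b ∷ B) = trans (cong₂ _⊕_ (•-zeroˡ b) (lincomb-zero B)) (⊕-identityˡ 0v)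

  lincomb-⊕ : ∀ {k} (c d : Vc k) (B : Vec V k) → lincomb (c ⊕ d) B ≡ lincomb c B ⊕ lincomb d B
  lincomb-⊕ []      []      []      = sym (⊕-identityˡ 0v)
  lincomb-⊕ (x ∷ c) (y ∷ d) (b ∷ B) = trans (cong₂ _⊕_ (•-distribʳ x y b) (lincomb-⊕ c d B)) (⊕-interchange _ _ _ _)

  lincomb-• : ∀ {k} s (c : Vc k) (B : Vec V k) → lincomb (s • c) B ≡ s • lincomb c B
  lincomb-• s []      []      = sym (•-zeroʳ s)
  lincomb-• s (x ∷ c) (b ∷ B) = trans (cong₂ _⊕_ (sym (•-assoc s x b)) (lincomb-• s c B)) (sym (•-distribˡ s _ _))

  lincomb-⊖ : ∀ {k} (c : Vc k) (B : Vec V k) → lincomb (⊖ c) B ≡ ⊖ lincomb c B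
  lincomb-⊖ c B = trans (cong (λ z → lincomb z B) (sym (-1• c))) (trans (lincomb-• (- 1#) c B) (-1• _))

  lincomb-++ : ∀ {j k} (c : Vc j) (d : Vc k) (C : Vec V j) (D : Vec V k) →
    lincomb (c Vec.++ d) (C Vec.++ D) ≡ lincomb c C ⊕ lincomb d D
  lincomb-++ []      d []      D = sym (⊕-identityˡ _)
  lincomb-++ (x ∷ c) d (b ∷ C) D = trans (cong (x • b ⊕_) (lincomb-++ c d C D)) (sym (⊕-assoc _ _ _))

  lincomb-injective : ∀ {k} (B : Vec V k) → LinIndep B → ∀ c d → lincomb c B ≡ lincomb d B → c ≡ d
  lincomb-injective B indep c d e = ⊕⊖≡0⇒≡ c d (indep _ (begin
      lincomb (c ⊕ ⊖ d) B           ≡⟨ lincomb-⊕ c (⊖ d) B ⟩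
      lincomb c B ⊕ lincomb (⊖ d) B ≡⟨ cong₂ _⊕_ e (lincomb-⊖ d B) ⟩
      lincomb d B ⊕ ⊖ lincomb d B   ≡⟨ ⊕-inverseʳ _ ⟩
      0v                            ∎))
    where open ≡-Reasoning

  -- pairings B a = (a·b₁, …, a·b_k); it vanishes iff span B ⊆ a^⊥
  pairings : ∀ {k} → Vec V k → V → Vc k
  pairings B a = Vec.map (dot a) B

  pairings-zero : ∀ {k} (B : Vec V k) → pairings B 0v ≡ 0v
  pairings-zero []      = refl
  pairings-zero (b ∷ B) = cong₂ _∷_ (dot-zeroˡ b) (pairings-zero B)

  dot-lincomb : ∀ {k} (a : V) (c : Vc k) (B : Vec V k) → dot a (lincomb c B) ≡ dot c (pairings B a)
  dot-lincomb a []      []      = dot-zeroʳ a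
  dot-lincomb a (x ∷ c) (b ∷ B) = trans (dot-⊕ʳ a _ _) (cong₂ _+F_ (dot-•ʳ a x b) (dot-lincomb a c B))

  annSize : ∀ {k} → Vec V k → ℕ
  annSize B = ∑V n (λ a → 𝟙 (does (pairings B a ≟v 0v)))

  -- Double counting of the pairs (a, c) ∈ F^n × F^k with a·(lincomb c B) = 0,
  -- i.e. c·(pairings B a) = 0, once per a and once per c via the kernel count.
  module PairCount {k} (B : Vec V k) where
    pairsByA : ℕ
    pairsByA = ∑V n (λ a → kerSize k (pairings B a))

    pairsByC : ℕ
    pairsByC = ∑V k (λ c → kerSize n (lincomb c B))

    pairs-swap : pairsByA ≡ pairsByC
    pairs-swap = trans (∑-swap (allV n) (allV k) _)
      (∑-cong (allV k) (λ c → ∑-cong (allV n) (λ a → cong (λ z → 𝟙 (does (z ≟F 0#))) (sym (dot-lincomb a c B)))))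

    pairs-byA : q * pairsByA ≡ q ^ n * q ^ k + annSize B * (q' * q ^ k)
    pairs-byA = begin
        q * pairsByA
          ≡⟨ sym (∑-*ˡ (allV n) q _) ⟩
        ∑V n (λ a → q * kerSize k (pairings B a))
          ≡⟨ ∑-cong (allV n) (λ a → kerSize-count k (pairings B a)) ⟩
        ∑V n (λ a → q ^ k + 𝟙 (does (pairings B a ≟v 0v)) * (q' * q ^ k))
          ≡⟨ ∑-+ (allV n) _ _ ⟩
        ∑V n (λ _ → q ^ k) + ∑V n (λ a → 𝟙 (does (pairings B a ≟v 0v)) * (q' * q ^ k))
          ≡⟨ cong₂ _+_ (∑V-const n _) (∑-*ʳ (allV n) _ _) ⟩
        q ^ n * q ^ k + annSize B * (q' * q ^ k) ∎
      where open ≡-Reasoning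

    -- for independent B, lincomb c B = 0 only for c = 0
    pairs-byC : LinIndep B → q * pairsByC ≡ q ^ n * q ^ k + q' * q ^ n
    pairs-byC indep = begin
        q * pairsByC
          ≡⟨ sym (∑-*ˡ (allV k) q _) ⟩
        ∑V k (λ c → q * kerSize n (lincomb c B))
          ≡⟨ ∑-cong (allV k) (λ c → kerSize-count n (lincomb c B)) ⟩
        ∑V k (λ c → q ^ n + 𝟙 (does (lincomb c B ≟v 0v)) * (q' * q ^ n))
          ≡⟨ ∑-+ (allV k) _ _ ⟩
        ∑V k (λ _ → q ^ n) + ∑V k (λ c → 𝟙 (does (lincomb c B ≟v 0v)) * (q' * q ^ n))
          ≡⟨ cong₂ _+_ (trans (∑V-const k _) (ℕP.*-comm (q ^ k) (q ^ n)))
                       (∑-cong (allV k) (λ c → cong (_* (q' * q ^ n)) (zeroTest c))) ⟩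
        q ^ n * q ^ k + ∑V k (λ c → 𝟙 (does (c ≟v 0v)) * (q' * q ^ n))
          ≡⟨ cong (q ^ n * q ^ k +_) (EnumerationProperties.delta (vecEnumeration k) 0v (λ _ → q' * q ^ n)) ⟩
        q ^ n * q ^ k + q' * q ^ n ∎
      where
        open ≡-Reasoning
        zeroTest : ∀ c → 𝟙 (does (lincomb c B ≟v 0v)) ≡ 𝟙 (does (c ≟v 0v))
        zeroTest c with c ≟v 0v
        ... | yes refl = cong 𝟙 (does-yes (lincomb 0v B ≟v 0v) (lincomb-zero B))
        ... | no c≢0   = cong 𝟙 (does-no (lincomb c B ≟v 0v) (λ e → c≢0 (indep c e)))

  annSize-indep : ∀ {k} (B : Vec V k) → LinIndep B → annSize B * q ^ k ≡ q ^ n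
  annSize-indep {k} B indep = ℕP.*-cancelˡ-≡ _ _ q' {{ℕ.>-nonZero 1≤q'}}
    (trans (rearrange q' (annSize B) (q ^ k)) (ℕP.+-cancelˡ-≡ (q ^ n * q ^ k) _ _
      (trans (sym pairs-byA) (trans (cong (q *_) pairs-swap) (pairs-byC indep)))))
    where
      open PairCount B
      rearrange : ∀ Q W K → Q * (W * K) ≡ W * (Q * K)
      rearrange = solve-∀

  -- an independent family in F^n has at most n members (its annihilator is nonempty)
  indep-length≤n : ∀ {j} (C : Vec V j) → LinIndep C → j ≤ n
  indep-length≤n {j} C indep = ^-cancel-≤ j n (subst (q ^ j ≤_) (annSize-indep C indep) q^j≤)
    where
      1≤annSize : 1 ≤ annSize C
      1≤annSize = subst (_≤ annSize C) (cong 𝟙 (does-yes (pairings C 0v ≟v 0v) (pairings-zero C)))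
                        (EnumerationProperties.term≤∑ (vecEnumeration n) (λ a → 𝟙 (does (pairings C a ≟v 0v))) 0v)
      q^j≤ : q ^ j ≤ annSize C * q ^ j
      q^j≤ = subst (_≤ annSize C * q ^ j) (ℕP.*-identityˡ (q ^ j)) (ℕP.*-monoˡ-≤ (q ^ j) 1≤annSize)

  mult : V → Subspace → ℕ
  mult v U = ∑V (dim U) (λ c → 𝟙 (does (lincomb c (basis U) ≟v v)))

  mult-∈ : ∀ v U → v ∈S U → mult v U ≡ 1
  mult-∈ v U (c₀ , e) = trans (∑-cong (allV (dim U)) (λ c → cong 𝟙 (sameTest c))) (allV-once (dim U) c₀)
    where
      sameTest : ∀ c → does (lincomb c (basis U) ≟v v) ≡ does (c ≟v c₀)
      sameTest c with c ≟v c₀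
      ... | yes refl = does-yes (lincomb c (basis U) ≟v v) e
      ... | no c≢c₀  = does-no (lincomb c (basis U) ≟v v)
                         (λ e' → c≢c₀ (lincomb-injective (basis U) (indep U) c c₀ (trans e' (sym e))))

  mult-∉ : ∀ v U → ¬ v ∈S U → mult v U ≡ 0
  mult-∉ v U v∉U = ∑-zero (allV (dim U)) _ (λ c → cong 𝟙 (does-no (lincomb c (basis U) ≟v v) (λ e → v∉U (c , e))))

  mult-pos : ∀ v U → 0 < mult v U → v ∈S U
  mult-pos v U p with ∑-pos (allV (dim U)) _ p
  ... | c , p' = c , 𝟙-pos (lincomb c (basis U) ≟v v) p'

  mult≤1 : ∀ v U → mult v U ≤ 1
  mult≤1 v U with mult v U in eq
  ... | zero  = z≤n
  ... | suc _ = ℕP.≤-reflexive (trans (sym eq) (mult-∈ v U (mult-pos v U (subst (0 <_) (sym eq) (s≤s z≤n)))))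

  allVecs≡allV : ∀ k → allVecs k ≡ allV k
  allVecs≡allV zero    = refl
  allVecs≡allV (suc k) = cong (λ l → concatMap (λ x → map (x ∷_) l) (FiniteField.elements F)) (allVecs≡allV k)

  memberᵇ≡mult : ∀ v U → 𝟙 (memberᵇ v U) ≡ mult v U
  memberᵇ≡mult v U rewrite allVecs≡allV (dim U) = any≡∑ _ (allV (dim U)) (mult≤1 v U)

  ∑-span : ∀ U (g : V → ℕ) → ∑V n (λ v → g v * mult v U) ≡ ∑V (dim U) (λ c → g (lincomb c (basis U)))
  ∑-span U g = begin
      ∑V n (λ v → g v * mult v U)
        ≡⟨ ∑-cong (allV n) (λ v → trans (ℕP.*-comm (g v) _) (sym (∑-*ʳ (allV (dim U)) (g v) _))) ⟩
      ∑V n (λ v → ∑V (dim U) (λ c → 𝟙 (does (lincomb c (basis U) ≟v v)) * g v))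
        ≡⟨ ∑-swap (allV n) (allV (dim U)) _ ⟩
      ∑V (dim U) (λ c → ∑V n (λ v → 𝟙 (does (lincomb c (basis U) ≟v v)) * g v))
        ≡⟨ ∑-cong (allV (dim U)) (λ c → trans (∑-cong (allV n) (λ v → cong (λ b → 𝟙 b * g v) (does-sym _ v)))
                                               (EnumerationProperties.delta (vecEnumeration n) _ g)) ⟩
      ∑V (dim U) (λ c → g (lincomb c (basis U))) ∎
    where
      open ≡-Reasoning
      does-sym : ∀ (u v : V) → does (u ≟v v) ≡ does (v ≟v u)
      does-sym u v with u ≟v v
      ... | yes e  = sym (does-yes (v ≟v u) (sym e))
      ... | no u≢v = sym (does-no (v ≟v u) (λ e → u≢v (sym e)))

  span-size : ∀ U → ∑V n (λ v → mult v U) ≡ q ^ dim U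
  span-size U = trans (∑-cong (allV n) (λ v → sym (ℕP.*-identityˡ (mult v U)))) (trans (∑-span U (λ _ → 1)) (∑V-1 (dim U)))

module PartitionSums (F : FiniteField) (n : ℕ) (P : List (VectorSpace.Subspace F n))
                     (isP : VectorSpace.IsSubspacePartition F n P) where
  open FiniteField F using (0#) renaming (_≟_ to _≟F_)
  open FieldVectors F
  open LinearEquation F
  open VectorSpace F n
  open Spans F n

  N : ℕ
  N = length P

  member : Fin N → Subspace
  member = lookup P

  k : Fin N → ℕ
  k i = dim (member i)

  B : (i : Fin N) → Vec V (k i)
  B i = basis (member i)

  ∑P : (Fin N → ℕ) → ℕ
  ∑P f = ∑ (List.allFin N) f

  open EnumerationProperties (vecEnumeration n) using (split)

  cover : V → ℕ
  cover v = ∑P (λ i → mult v (member i))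

  cover-zero : cover 0v ≡ N
  cover-zero = begin
      ∑P (λ i → mult 0v (member i)) ≡⟨ ∑-cong (List.allFin N) (λ i → mult-∈ 0v (member i) (0v , lincomb-zero (B i))) ⟩
      ∑P (λ _ → 1)                  ≡⟨ ∑-const (List.allFin N) 1 ⟩
      length (List.allFin N) * 1    ≡⟨ ℕP.*-identityʳ _ ⟩
      length (List.allFin N)        ≡⟨ ListP.length-tabulate {n = N} (λ i → i) ⟩
      N                             ∎
    where open ≡-Reasoning

  cover-nonzero : ∀ v → ¬ v ≡ 0v → cover v ≡ 1
  cover-nonzero v v≢0 with proj₁ (proj₂ isP) v v≢0
  ... | i₀ , v∈i₀ = trans (∑-cong (List.allFin N) onlyAt) (Enumeration.once (finEnumeration N) i₀)
    where
      onlyAt : ∀ j → mult v (member j) ≡ 𝟙 (does (j Fin.≟ i₀))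
      onlyAt j with j Fin.≟ i₀
      ... | yes refl = mult-∈ v (member j) v∈i₀
      ... | no j≢i₀  = mult-∉ v (member j) (λ v∈j → j≢i₀ (proj₂ (proj₂ isP) v v≢0 j i₀ v∈j v∈i₀))

  -- Σ_{S ∈ P} Σ_{v ∈ S} g v  counts every nonzero vector once and 0 once per member
  ∑-partition : (g : V → ℕ) → ∑P (λ i → ∑V (k i) (λ c → g (lincomb c (B i)))) + g 0v ≡ g 0v * N + ∑V n g
  ∑-partition g = begin
      ∑P (λ i → ∑V (k i) (λ c → g (lincomb c (B i)))) + g 0v
        ≡⟨ cong (_+ g 0v) byVectors ⟩
      ∑V n (λ v → g v * cover v) + g 0v
        ≡⟨ cong (_+ g 0v) (split 0v _) ⟩
      g 0v * cover 0v + ∑V n (λ v → nz v * (g v * cover v)) + g 0v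
        ≡⟨ cong₂ (λ x y → g 0v * x + y + g 0v) cover-zero (∑-cong (allV n) nonzeroTerm) ⟩
      g 0v * N + ∑V n (λ v → nz v * g v) + g 0v
        ≡⟨ regroup (g 0v * N) _ (g 0v) ⟩
      g 0v * N + (g 0v + ∑V n (λ v → nz v * g v))
        ≡⟨ cong (g 0v * N +_) (sym (split 0v g)) ⟩
      g 0v * N + ∑V n g ∎
    where
      open ≡-Reasoning
      nz : V → ℕ
      nz v = 𝟙 (not (does (v ≟v 0v)))
      regroup : ∀ x y z → x + y + z ≡ x + (z + y)
      regroup = solve-∀
      byVectors : ∑P (λ i → ∑V (k i) (λ c → g (lincomb c (B i)))) ≡ ∑V n (λ v → g v * cover v)
      byVectors = trans (∑-cong (List.allFin N) (λ i → sym (∑-span (member i) g)))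
                 (trans (∑-swap (List.allFin N) (allV n) _) (∑-cong (allV n) (λ v → ∑-*ˡ (List.allFin N) (g v) _)))
      nonzeroTerm : ∀ v → nz v * (g v * cover v) ≡ nz v * g v
      nonzeroTerm v with v ≟v 0v
      ... | yes _   = refl
      ... | no v≢0 = trans (cong (λ z → g v * z + 0) (cover-nonzero v v≢0)) (cong (_+ 0) (ℕP.*-identityʳ (g v)))

  ∑q^k : ℕ
  ∑q^k = ∑P (λ i → q ^ k i)

  card-identity : ∑q^k + 1 ≡ N + q ^ n
  card-identity = begin
      ∑q^k + 1                                   ≡⟨ cong (_+ 1) (∑-cong (List.allFin N) (λ i → sym (∑V-1 (k i)))) ⟩
      ∑P (λ i → ∑V (k i) (λ _ → 1)) + 1          ≡⟨ ∑-partition (λ _ → 1) ⟩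
      1 * N + ∑V n (λ _ → 1)                     ≡⟨ cong₂ _+_ (ℕP.*-identityˡ N) (∑V-1 n) ⟩
      N + q ^ n                                  ∎
    where open ≡-Reasoning

  -- inH i a = [member i ⊆ a^⊥]
  inH : Fin N → V → ℕ
  inH i a = 𝟙 (does (pairings (B i) a ≟v 0v))

  inH-zero : ∀ i → inH i 0v ≡ 1
  inH-zero i = cong 𝟙 (does-yes (pairings (B i) 0v ≟v 0v) (pairings-zero (B i)))

  hyperplaneWeight : V → ℕ
  hyperplaneWeight a = ∑P (λ i → inH i a * q ^ k i)

  -- Counting the vectors of a^⊥ through the partition: a member S contributes
  -- |S ∩ a^⊥|, which is q^(dim S) if S ⊆ a^⊥ and q^(dim S - 1) otherwise.
  module KernelThroughPartition (a : V) where
    inKer : V → ℕ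
    inKer v = 𝟙 (does (dot a v ≟F 0#))

    inKer-zero : inKer 0v ≡ 1
    inKer-zero = cong 𝟙 (does-yes (dot a 0v ≟F 0#) (dot-zeroʳ a))

    kerIn : Fin N → ℕ
    kerIn i = kerSize (k i) (pairings (B i) a)

    kernel-through-partition : ∑P kerIn + 1 ≡ N + kerSize n a
    kernel-through-partition = begin
        ∑P kerIn + 1
          ≡⟨ cong₂ _+_ (∑-cong (List.allFin N) (λ i → ∑-cong (allV (k i))
                 (λ c → cong (λ z → 𝟙 (does (z ≟F 0#))) (sym (dot-lincomb a c (B i))))))
               (sym inKer-zero) ⟩
        ∑P (λ i → ∑V (k i) (λ c → inKer (lincomb c (B i)))) + inKer 0v
          ≡⟨ ∑-partition inKer ⟩
        inKer 0v * N + ∑V n inKer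
          ≡⟨ cong₂ _+_ (trans (cong (_* N) inKer-zero) (ℕP.*-identityˡ N))
                       (∑-cong (allV n) (λ v → cong (λ z → 𝟙 (does (z ≟F 0#))) (dot-comm a v))) ⟩
        N + kerSize n a ∎
      where open ≡-Reasoning

    kernel-by-members : q * ∑P kerIn ≡ ∑q^k + q' * hyperplaneWeight a
    kernel-by-members = begin
        q * ∑P kerIn
          ≡⟨ sym (∑-*ˡ (List.allFin N) q kerIn) ⟩
        ∑P (λ i → q * kerIn i)
          ≡⟨ ∑-cong (List.allFin N) (λ i → kerSize-count (k i) (pairings (B i) a)) ⟩
        ∑P (λ i → q ^ k i + inH i a * (q' * q ^ k i))
          ≡⟨ ∑-+ (List.allFin N) _ _ ⟩
        ∑q^k + ∑P (λ i → inH i a * (q' * q ^ k i))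
          ≡⟨ cong (∑q^k +_) (trans (∑-cong (List.allFin N) (λ i → swap (inH i a) q' (q ^ k i))) (∑-*ˡ (List.allFin N) q' _)) ⟩
        ∑q^k + q' * hyperplaneWeight a ∎
      where
        open ≡-Reasoning
        swap : ∀ x Q y → x * (Q * y) ≡ Q * (x * y)
        swap = solve-∀

  -- For a ≠ 0:  Σ_{S ⊆ a^⊥} q^(dim S) = |P| - 1, comparing the count above
  -- with |a^⊥| = q^(n-1) and with card-identity.
  hyperplaneWeight+1≡N : ∀ a → ¬ a ≡ 0v → hyperplaneWeight a + 1 ≡ N
  hyperplaneWeight+1≡N a a≢0 = ℕP.*-cancelˡ-≡ _ _ q' {{ℕ.>-nonZero 1≤q'}}
    (cancel ∑q^k N (q ^ n) q' (hyperplaneWeight a) card-identity scaled)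
    where
      open KernelThroughPartition a
      hyperplaneSize : q * kerSize n a ≡ q ^ n
      hyperplaneSize = trans (kerSize-count n a)
        (trans (cong (λ b → q ^ n + 𝟙 b * (q' * q ^ n)) (does-no (a ≟v 0v) a≢0)) (ℕP.+-identityʳ _))
      scaled : ∑q^k + q' * hyperplaneWeight a + suc q' ≡ suc q' * N + q ^ n
      scaled = begin
        ∑q^k + q' * hyperplaneWeight a + suc q' ≡⟨ cong₂ _+_ (sym kernel-by-members) (sym q≡1+q') ⟩
        q * ∑P kerIn + q                        ≡⟨ cong (q * ∑P kerIn +_) (sym (ℕP.*-identityʳ q)) ⟩
        q * ∑P kerIn + q * 1                    ≡⟨ sym (ℕP.*-distribˡ-+ q (∑P kerIn) 1) ⟩
        q * (∑P kerIn + 1)                      ≡⟨ cong (q *_) kernel-through-partition ⟩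
        q * (N + kerSize n a)                   ≡⟨ ℕP.*-distribˡ-+ q N _ ⟩
        q * N + q * kerSize n a                 ≡⟨ cong₂ (λ Q z → Q * N + z) q≡1+q' hyperplaneSize ⟩
        suc q' * N + q ^ n                      ∎
        where open ≡-Reasoning
      cancel : ∀ A N Qn Q w → A + 1 ≡ N + Qn → A + Q * w + suc Q ≡ suc Q * N + Qn → Q * (w + 1) ≡ Q * N
      cancel A N Qn Q w e₁ e₂ = ℕP.+-cancelˡ-≡ (N + Qn) _ _
        (trans (cong (_+ Q * (w + 1)) (sym e₁)) (trans (l₁ A Q w) (trans e₂ (l₂ N Qn Q))))
        where
          l₁ : ∀ A Q w → A + 1 + Q * (w + 1) ≡ A + Q * w + suc Q
          l₁ = solve-∀
          l₂ : ∀ N Qn Q → suc Q * N + Qn ≡ N + Qn + Q * N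
          l₂ = solve-∀

  replicate-++ : ∀ j j' → replicate j 0# Vec.++ replicate j' 0# ≡ replicate (j + j') 0#
  replicate-++ zero    j' = refl
  replicate-++ (suc j) j' = cong (0# ∷_) (replicate-++ j j')

  -- bases of two distinct members together are independent (their spans meet in 0)
  indep-++ : ∀ i j → ¬ i ≡ j → LinIndep (B i Vec.++ B j)
  indep-++ i j i≢j c e with Vec.splitAt (k i) c
  ... | c₁ , c₂ , refl = trans (cong₂ Vec._++_ c₁≡0 c₂≡0) (replicate-++ (k i) (k j))
    where
      sum≡0 : lincomb c₁ (B i) ⊕ lincomb c₂ (B j) ≡ 0v
      sum≡0 = trans (sym (lincomb-++ c₁ c₂ (B i) (B j))) e
      inBoth : lincomb c₂ (B j) ≡ lincomb (⊖ c₁) (B i)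
      inBoth = trans (⊕≡0⇒≡⊖ _ _ sum≡0) (sym (lincomb-⊖ c₁ (B i)))
      v≡0 : lincomb c₂ (B j) ≡ 0v
      v≡0 with lincomb c₂ (B j) ≟v 0v
      ... | yes v≡0 = v≡0
      ... | no v≢0  = ⊥-elim (i≢j (proj₂ (proj₂ isP) _ v≢0 i j (⊖ c₁ , sym inBoth) (c₂ , refl)))
      c₂≡0 : c₂ ≡ replicate (k j) 0#
      c₂≡0 = indep (member j) c₂ v≡0
      c₁≡0 : c₁ ≡ replicate (k i) 0#
      c₁≡0 = indep (member i) c₁ (trans (sym (⊕-identityʳ _)) (trans (cong (lincomb c₁ (B i) ⊕_) (sym v≡0)) sum≡0))

  zeroTest-++ : ∀ {j j'} (u : Vc j) (w : Vc j') →
    𝟙 (does ((u Vec.++ w) ≟v 0v)) ≡ 𝟙 (does (u ≟v 0v)) * 𝟙 (does (w ≟v 0v))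
  zeroTest-++ []      w = sym (ℕP.+-identityʳ _)
  zeroTest-++ (x ∷ u) w = begin
      𝟙 (does (x ≟F 0#) ∧ does ((u Vec.++ w) ≟v 0v))          ≡⟨ 𝟙-∧ (does (x ≟F 0#)) _ ⟩
      𝟙 (does (x ≟F 0#)) * 𝟙 (does ((u Vec.++ w) ≟v 0v))     ≡⟨ cong (𝟙 (does (x ≟F 0#)) *_) (zeroTest-++ u w) ⟩
      𝟙 (does (x ≟F 0#)) * (𝟙 (does (u ≟v 0v)) * 𝟙 (does (w ≟v 0v)))
        ≡⟨ sym (ℕP.*-assoc (𝟙 (does (x ≟F 0#))) _ _) ⟩
      𝟙 (does (x ≟F 0#)) * 𝟙 (does (u ≟v 0v)) * 𝟙 (does (w ≟v 0v))
        ≡⟨ cong (_* 𝟙 (does (w ≟v 0v))) (sym (𝟙-∧ (does (x ≟F 0#)) (does (u ≟v 0v)))) ⟩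
      𝟙 (does (x ≟F 0#) ∧ does (u ≟v 0v)) * 𝟙 (does (w ≟v 0v)) ∎
    where open ≡-Reasoning

  inH-pair : ∀ i j → ¬ i ≡ j → ∑V n (λ a → inH i a * inH j a) * (q ^ k i * q ^ k j) ≡ q ^ n
  inH-pair i j i≢j = begin
      ∑V n (λ a → inH i a * inH j a) * (q ^ k i * q ^ k j)
        ≡⟨ cong₂ _*_ (∑-cong (allV n) pairTest) (sym (ℕP.^-distribˡ-+-* q (k i) (k j))) ⟩
      annSize (B i Vec.++ B j) * q ^ (k i + k j)
        ≡⟨ annSize-indep (B i Vec.++ B j) (indep-++ i j i≢j) ⟩
      q ^ n ∎
    where
      open ≡-Reasoning
      pairTest : ∀ a → inH i a * inH j a ≡ 𝟙 (does (pairings (B i Vec.++ B j) a ≟v 0v))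
      pairTest a = sym (trans (cong (λ z → 𝟙 (does (z ≟v 0v))) (VecP.map-++ (dot a) (B i) (B j)))
                              (zeroTest-++ (pairings (B i) a) (pairings (B j) a)))

  ∑-average : (h : V → ℕ) (f : Fin N → ℕ) →
    ∑V n (λ a → h a * ∑P (λ i → inH i a * f i)) ≡ ∑P (λ i → ∑V n (λ a → h a * inH i a) * f i)
  ∑-average h f = begin
      ∑V n (λ a → h a * ∑P (λ i → inH i a * f i))
        ≡⟨ ∑-cong (allV n) (λ a → sym (∑-*ˡ (List.allFin N) (h a) _)) ⟩
      ∑V n (λ a → ∑P (λ i → h a * (inH i a * f i)))
        ≡⟨ ∑-swap (allV n) (List.allFin N) _ ⟩
      ∑P (λ i → ∑V n (λ a → h a * (inH i a * f i)))
        ≡⟨ ∑-cong (List.allFin N) (λ i → trans (∑-cong (allV n) (λ a → sym (ℕP.*-assoc (h a) _ (f i))))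
                                               (∑-*ʳ (allV n) (f i) _)) ⟩
      ∑P (λ i → ∑V n (λ a → h a * inH i a) * f i) ∎
    where open ≡-Reasoning

module Hyperplanes (F : FiniteField) (n' : ℕ) where
  open FiniteField F using (Carrier; 0#; 1#; -_) renaming (_*_ to _*F_; _≟_ to _≟F_)
  open FieldVectors F
  open LinearEquation F

  n : ℕ
  n = suc n'

  open VectorSpace F n
  open Spans F n
  open EnumerationProperties (vecEnumeration n) using (split; ∑-≤-≡)

  indep-∷ : ∀ {j} (C : Vec V j) (v : V) → LinIndep C → (∀ c → ¬ lincomb c C ≡ v) → LinIndep (v ∷ C)
  indep-∷ C v indepC v∉C (x ∷ c) e with x ≟F 0#
  ... | yes refl = cong (0# ∷_) (indepC c (trans (sym (⊕-identityˡ _)) (trans (cong (_⊕ lincomb c C) (sym (•-zeroˡ v))) e)))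
  ... | no x≢0 = ⊥-elim (v∉C (y • c) (begin
        lincomb (y • c) C          ≡⟨ lincomb-• y c C ⟩
        y • lincomb c C            ≡⟨ cong (y •_) (⊕≡0⇒≡⊖ (x • v) _ e) ⟩
        y • ⊖ (x • v)              ≡⟨ cong (y •_) (sym (-1• _)) ⟩
        y • (- 1#) • x • v         ≡⟨ cong (y •_) (•-assoc _ _ v) ⟩
        y • ((- 1#) *F x) • v      ≡⟨ •-assoc _ _ v ⟩
        (y *F ((- 1#) *F x)) • v   ≡⟨ cong (_• v) (-inv*-x x x≢0) ⟩
        1# • v                     ≡⟨ •-identity v ⟩
        v                          ∎))
    where
      open ≡-Reasoning
      y : Carrier
      y = (- 1#) *F inv x x≢0

  module Kernel (a : V) (a≢0 : ¬ a ≡ 0v) where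

    inKer : V → ℕ
    inKer v = 𝟙 (does (dot a v ≟F 0#))

    kernel-size : ∑V n inKer ≡ q ^ n'
    kernel-size = ℕP.*-cancelˡ-≡ _ _ q
      (trans (cong (q *_) (∑-cong (allV n) (λ v → cong (λ z → 𝟙 (does (z ≟F 0#))) (dot-comm a v))))
             (trans (kerSize-count n a) (trans (cong (λ b → q ^ n + 𝟙 b * (q' * q ^ n)) (does-no (a ≟v 0v) a≢0))
                                               (ℕP.+-identityʳ _))))

    mult≤inKer : ∀ U → pairings (basis U) a ≡ 0v → ∀ v → mult v U ≤ inKer v
    mult≤inKer U U⊆a⊥ v with mult v U in eq
    ... | zero  = z≤n
    ... | suc j with mult-pos v U (subst (0 <_) (sym eq) (s≤s z≤n))
    ...   | c , refl = subst (suc j ≤_) (sym (cong 𝟙 (does-yes (dot a (lincomb c (basis U)) ≟F 0#) orthogonal)))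
                              (subst (_≤ 1) eq (mult≤1 _ U))
      where
        orthogonal : dot a (lincomb c (basis U)) ≡ 0#
        orthogonal = trans (dot-lincomb a c (basis U)) (trans (cong (dot c) U⊆a⊥) (dot-zeroʳ c))

    -- an n'-dimensional subspace inside a^⊥ is a^⊥ (both have q^n' elements)
    kernel-unique : ∀ U → dim U ≡ n' → pairings (basis U) a ≡ 0v → ∀ v → memberᵇ v U ≡ does (dot a v ≟F 0#)
    kernel-unique U dimU U⊆a⊥ v = 𝟙-injective (trans (memberᵇ≡mult v U)
      (∑-≤-≡ (λ v → mult v U) inKer (mult≤inKer U U⊆a⊥) (trans (span-size U) (trans (cong (q ^_) dimU) (sym kernel-size))) v))

    -- j < n' independent vectors of a^⊥ do not span it: |a^⊥| - |span C| = q^n' - q^j > 0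
    kernel-beyond-span : ∀ {j} (C : Vec V j) (indepC : LinIndep C) → pairings C a ≡ 0v → j < n' →
      ∃ λ v → dot a v ≡ 0# × (∀ c → ¬ lincomb c C ≡ v)
    kernel-beyond-span {j} C indepC C⊆a⊥ j<n' = v , v∈a⊥ , v∉C
      where
        U : Subspace
        U = subspace j C indepC
        excess : V → ℕ
        excess v = inKer v ∸ mult v U
        excess-pos : 0 < ∑V n excess
        excess-pos with ∑V n excess in eq
        ... | suc _ = s≤s z≤n
        ... | zero  = ⊥-elim (ℕP.<-irrefl spanIsKernel (ℕP.^-monoʳ-< q q≥2 j<n'))
          where
            spanIsKernel : q ^ j ≡ q ^ n'
            spanIsKernel = begin
              q ^ j                                    ≡⟨ sym (span-size U) ⟩
              ∑V n (λ v → mult v U)                    ≡⟨ sym (ℕP.+-identityʳ _) ⟩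
              ∑V n (λ v → mult v U) + 0                ≡⟨ cong (∑V n (λ v → mult v U) +_) (sym eq) ⟩
              ∑V n (λ v → mult v U) + ∑V n excess      ≡⟨ sym (∑-+ (allV n) _ excess) ⟩
              ∑V n (λ v → mult v U + excess v)         ≡⟨ ∑-cong (allV n) (λ v → ℕP.m+[n∸m]≡n (mult≤inKer U C⊆a⊥ v)) ⟩
              ∑V n inKer                               ≡⟨ kernel-size ⟩
              q ^ n'                                   ∎
              where open ≡-Reasoning
        found : ∃ λ v → 0 < excess v
        found = ∑-pos (allV n) excess excess-pos
        v : V
        v = proj₁ found
        v∈a⊥ : dot a v ≡ 0#
        v∈a⊥ = positive (dot a v ≟F 0#) (mult v U) (proj₂ found)
          where
            positive : ∀ {Q : Set} (d : Dec Q) h → 0 < 𝟙 (does d) ∸ h → Q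
            positive (yes p) h       _  = p
            positive (no _)  zero    ()
            positive (no _)  (suc h) ()
        v∉C : ∀ c → ¬ lincomb c C ≡ v
        v∉C c e = ℕP.<-irrefl refl (ℕP.<-≤-trans (proj₂ found)
                    (subst (λ z → inKer v ∸ z ≤ 0) (sym (mult-∈ v U (c , e)))
                           (ℕP.≤-reflexive (ℕP.m≤n⇒m∸n≡0 (𝟙≤1 (does (dot a v ≟F 0#)))))))

    -- a^⊥ contains j independent vectors for every j ≤ n', by greedy extension
    independent-in-kernel : ∀ j → j ≤ n' → Σ (Vec V j) λ C → LinIndep C × pairings C a ≡ 0v
    independent-in-kernel zero    _    = [] , (λ { [] _ → refl }) , refl
    independent-in-kernel (suc j) j<n' = (v ∷ C) , indep-∷ C v indepC v∉C , cong₂ _∷_ v∈a⊥ C⊆a⊥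
      where
        smaller : Σ (Vec V j) λ C → LinIndep C × pairings C a ≡ 0v
        smaller = independent-in-kernel j (ℕP.≤-trans (ℕP.n≤1+n j) j<n')
        C : Vec V j
        C = proj₁ smaller
        indepC : LinIndep C
        indepC = proj₁ (proj₂ smaller)
        C⊆a⊥ : pairings C a ≡ 0v
        C⊆a⊥ = proj₂ (proj₂ smaller)
        extension : ∃ λ v → dot a v ≡ 0# × (∀ c → ¬ lincomb c C ≡ v)
        extension = kernel-beyond-span C indepC C⊆a⊥ j<n'
        v : V
        v = proj₁ extension
        v∈a⊥ : dot a v ≡ 0#
        v∈a⊥ = proj₁ (proj₂ extension)
        v∉C : ∀ c → ¬ lincomb c C ≡ v
        v∉C = proj₂ (proj₂ extension)

  kernelHyperplane : (a : V) → ¬ a ≡ 0v →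
    ∃ λ (H : Subspace) → dim H ≡ n' × (∀ v → memberᵇ v H ≡ does (dot a v ≟F 0#))
  kernelHyperplane a a≢0 = H , refl , Kernel.kernel-unique a a≢0 H refl (proj₂ (proj₂ family))
    where
      family : Σ (Vec V n') λ C → LinIndep C × pairings C a ≡ 0v
      family = Kernel.independent-in-kernel a a≢0 n' ℕP.≤-refl
      H : Subspace
      H = subspace n' (proj₁ family) (proj₁ (proj₂ family))

  -- the annihilator of a hyperplane H has q = q^(n-n') elements, so besides 0 it
  -- contains q - 1 ≥ 1 nonzero functionals
  module Annihilator (H : Subspace) (dimH : dim H ≡ n') where
    annH : V → ℕ
    annH a = 𝟙 (does (pairings (basis H) a ≟v 0v))

    nonzeroAnn : V → Bool
    nonzeroAnn a = not (does (a ≟v 0v)) ∧ does (pairings (basis H) a ≟v 0v)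

    annSize≡q : annSize (basis H) ≡ q
    annSize≡q = ℕP.*-cancelʳ-≡ _ _ (q ^ n') {{q^≢0 n'}}
      (subst (λ z → annSize (basis H) * q ^ z ≡ q * q ^ n') dimH (annSize-indep (basis H) (indep H)))

    nonzero-count : q' ≡ ∑V n (λ a → 𝟙 (nonzeroAnn a))
    nonzero-count = ℕP.+-cancelˡ-≡ 1 _ _ (trans (sym q≡1+q') (trans (sym annSize≡q) (trans (split 0v annH)
      (cong₂ _+_ (cong 𝟙 (does-yes (pairings (basis H) 0v ≟v 0v) (pairings-zero (basis H))))
                 (∑-cong (allV n) (λ a → sym (𝟙-∧ (not (does (a ≟v 0v))) _)))))))

    witnessed : ∃ λ a → nonzeroAnn a ≡ true
    witnessed = ∑-witness (allV n) nonzeroAnn (subst (0 <_) nonzero-count 1≤q')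

    fromWitness : (a : V) → nonzeroAnn a ≡ true → ¬ a ≡ 0v × pairings (basis H) a ≡ 0v
    fromWitness a found = not-does (a ≟v 0v) (proj₁ both) , does-true (pairings (basis H) a ≟v 0v) (proj₂ both)
      where
        both : not (does (a ≟v 0v)) ≡ true × does (pairings (basis H) a ≟v 0v) ≡ true
        both = ∧-true (not (does (a ≟v 0v))) _ found

  hyperplaneFunctional : (H : Subspace) → dim H ≡ n' →
    ∃ λ a → ¬ a ≡ 0v × (∀ v → memberᵇ v H ≡ does (dot a v ≟F 0#))
  hyperplaneFunctional H dimH = a , a≢0 , Kernel.kernel-unique a a≢0 H dimH H⊆a⊥
    where
      open Annihilator H dimH
      a : V
      a = proj₁ witnessed
      a≢0 : ¬ a ≡ 0v
      a≢0 = proj₁ (fromWitness a (proj₂ witnessed))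
      H⊆a⊥ : pairings (basis H) a ≡ 0v
      H⊆a⊥ = proj₂ (fromWitness a (proj₂ witnessed))

module Translation (F : FiniteField) (n : ℕ) (P : List (VectorSpace.Subspace F n))
                   (isP : VectorSpace.IsSubspacePartition F n P) where
  open FiniteField F using (0#) renaming (_≟_ to _≟F_)
  open FieldVectors F
  open VectorSpace F n
  open Spans F n
  open PartitionSums F n P isP
  open Partition F n P using (nᵢ; supertailSize; b; β)

  count≡∑P : (p : Subspace → Bool) → count p P ≡ ∑P (λ i → 𝟙 (p (member i)))
  count≡∑P p = go P
    where
      go : (xs : List Subspace) → count p xs ≡ ∑ (List.allFin (length xs)) (λ i → 𝟙 (p (lookup xs i)))
      go []       = refl
      go (x ∷ xs) = cong (𝟙 (p x) +_) (trans (go xs) (sym (∑-tabulate Fin.suc (λ i → 𝟙 (p (lookup (x ∷ xs) i))))))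

  Θ-identity : ∀ i → q' * Θ q i + 1 ≡ q ^ i
  Θ-identity i = trans (cong (λ z → q' * z + 1) (sum-map≡∑ (q ^_) (List.upTo i))) (geometric i)
    where
      step : ∀ Q x y → Q * x + 1 ≡ y → Q * (1 + suc Q * x) + 1 ≡ suc Q * y
      step Q x y e = trans (expand Q x) (cong (suc Q *_) e)
        where
          expand : ∀ Q x → Q * (1 + suc Q * x) + 1 ≡ suc Q * (Q * x + 1)
          expand = solve-∀
      geometric : ∀ i → q' * ∑ (List.upTo i) (q ^_) + 1 ≡ q ^ i
      geometric zero    = cong (_+ 1) (ℕP.*-zeroʳ q')
      geometric (suc i) = trans (cong (λ z → q' * (1 + z) + 1) (trans (∑-applyUpTo suc (q ^_) i) (∑-*ˡ (List.upTo i) q (q ^_))))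
        (subst (λ Q → q' * (1 + Q * ∑ (List.upTo i) (q ^_)) + 1 ≡ Q * q ^ i) (sym q≡1+q') (step q' _ _ (geometric i)))

  containedᵇ≡pairings : (H : Subspace) (a : V) → (∀ v → memberᵇ v H ≡ does (dot a v ≟F 0#)) →
    ∀ {j} (C : Vec V j) → allVecᵇ (λ v → memberᵇ v H) C ≡ does (pairings C a ≟v 0v)
  containedᵇ≡pairings H a H≡a⊥ []      = refl
  containedᵇ≡pairings H a H≡a⊥ (v ∷ C) = cong₂ _∧_ (H≡a⊥ v) (containedᵇ≡pairings H a H≡a⊥ C)

  module Supertail (d t : ℕ) (tail≤t : ∀ i → k i < d → k i ≤ t) (t<d : t < d) where

    inTailᵇ : Fin N → Bool
    inTailᵇ i = does (suc (k i) ℕ.≤? d)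

    inTail : Fin N → ℕ
    inTail i = 𝟙 (inTailᵇ i)

    inRange≡inTail : ∀ o i → o ≤ k i → o ≤ t → does ((k i ∸ o) ℕ.<? (suc t ∸ o)) ≡ inTailᵇ i
    inRange≡inTail o i o≤k o≤t with k i ℕ.≤? t
    ... | yes k≤t = trans (does-yes ((k i ∸ o) ℕ.<? (suc t ∸ o)) (subst (suc (k i ∸ o) ≤_) (sym (ℕP.+-∸-assoc 1 o≤t)) (s≤s (ℕP.∸-monoˡ-≤ o k≤t))))
                          (sym (does-yes (suc (k i) ℕ.≤? d) (ℕP.≤-<-trans k≤t t<d)))
    ... | no k≰t  = trans (does-no ((k i ∸ o) ℕ.<? (suc t ∸ o)) inRange⇒k≤t)
                          (sym (does-no (suc (k i) ℕ.≤? d) (λ k<d → k≰t (tail≤t i k<d))))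
      where
        inRange⇒k≤t : ¬ (k i ∸ o < suc t ∸ o)
        inRange⇒k≤t lt = k≰t (ℕP.≤-pred (subst₂ _<_ (ℕP.m∸n+n≡m o≤k) (ℕP.m∸n+n≡m (ℕP.≤-trans o≤t (ℕP.n≤1+n t))) (ℕP.+-monoˡ-< o lt)))

    ∑-byDimension : ∀ o (c : Fin N → ℕ) (h : ℕ → ℕ) → (∀ i → o ≤ k i) → o ≤ t →
      ∑ (List.upTo (suc t ∸ o)) (λ j → ∑P (λ i → 𝟙 (does (k i ℕ.≟ o + j)) * c i) * h (o + j))
        ≡ ∑P (λ i → inTail i * (c i * h (k i)))
    ∑-byDimension o c h o≤k o≤t = begin
        ∑ range (λ j → ∑P (λ i → 𝟙 (does (k i ℕ.≟ o + j)) * c i) * h (o + j))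
          ≡⟨ ∑-cong range (λ j → trans (sym (∑-*ʳ (List.allFin N) (h (o + j)) _)) (∑-cong (List.allFin N) (λ i → atDim i j))) ⟩
        ∑ range (λ j → ∑P (λ i → 𝟙 (does (k i ℕ.≟ o + j)) * (c i * h (k i))))
          ≡⟨ ∑-swap range (List.allFin N) _ ⟩
        ∑P (λ i → ∑ range (λ j → 𝟙 (does (k i ℕ.≟ o + j)) * (c i * h (k i))))
          ≡⟨ ∑-cong (List.allFin N) (λ i → trans (∑-*ʳ range _ _)
               (cong (_* (c i * h (k i))) (trans (∑-upTo-shift o (k i) (o≤k i) L) (cong 𝟙 (inRange≡inTail o i (o≤k i) o≤t))))) ⟩
        ∑P (λ i → inTail i * (c i * h (k i))) ∎
      where
        open ≡-Reasoning
        L : ℕ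
        L = suc t ∸ o
        range : List ℕ
        range = List.upTo L
        atDim : ∀ i j → 𝟙 (does (k i ℕ.≟ o + j)) * c i * h (o + j) ≡ 𝟙 (does (k i ℕ.≟ o + j)) * (c i * h (k i))
        atDim i j = byCase (k i ℕ.≟ o + j)
          where
            byCase : (eq? : Dec (k i ≡ o + j)) → 𝟙 (does eq?) * c i * h (o + j) ≡ 𝟙 (does eq?) * (c i * h (k i))
            byCase (yes e) = trans (ℕP.*-assoc 1 (c i) _) (cong (λ z → 1 * (c i * h z)) (sym e))
            byCase (no _)  = refl

    tailWeight : V → ℕ
    tailWeight a = ∑P (λ i → inH i a * (inTail i * q ^ k i))

    β≡tailWeight : (d₁ : ℕ) → (∀ i → d₁ ≤ k i) → d₁ ≤ t → (H : Subspace) (a : V) →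
      (∀ v → memberᵇ v H ≡ does (dot a v ≟F 0#)) → β d₁ t H ≡ tailWeight a
    β≡tailWeight d₁ d₁≤k d₁≤t H a H≡a⊥ = begin
        β d₁ t H
          ≡⟨ sum-map≡∑ _ range ⟩
        ∑ range (λ j → b H (d₁ + j) * q ^ (d₁ + j))
          ≡⟨ ∑-cong range (λ j → cong (_* q ^ (d₁ + j)) (trans (count≡∑P _) (∑-cong (List.allFin N) (λ i → inHTest i j)))) ⟩
        ∑ range (λ j → ∑P (λ i → 𝟙 (does (k i ℕ.≟ d₁ + j)) * inH i a) * q ^ (d₁ + j))
          ≡⟨ ∑-byDimension d₁ (λ i → inH i a) (q ^_) d₁≤k d₁≤t ⟩
        ∑P (λ i → inTail i * (inH i a * q ^ k i))
          ≡⟨ ∑-cong (List.allFin N) (λ i → swap (inTail i) (inH i a) _) ⟩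
        tailWeight a ∎
      where
        open ≡-Reasoning
        range : List ℕ
        range = List.upTo (suc t ∸ d₁)
        swap : ∀ x y z → x * (y * z) ≡ y * (x * z)
        swap = solve-∀
        inHTest : ∀ i j → 𝟙 (does (k i ℕ.≟ d₁ + j) ∧ containedᵇ (member i) H) ≡ 𝟙 (does (k i ℕ.≟ d₁ + j)) * inH i a
        inHTest i j = trans (𝟙-∧ (does (k i ℕ.≟ d₁ + j)) _) (cong (λ z → 𝟙 (does (k i ℕ.≟ d₁ + j)) * 𝟙 z) (containedᵇ≡pairings H a H≡a⊥ (B i)))

    tailSize : ℕ
    tailSize = ∑P inTail

    tailWeightAll : ℕ
    tailWeightAll = ∑P (λ i → inTail i * q ^ k i)

    supertailSize≡tailSize : supertailSize d ≡ tailSize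
    supertailSize≡tailSize = count≡∑P _

    Θ-sum : 1 ≤ t → q' * sumFromTo 1 t (λ i → nᵢ i * Θ q i) + tailSize ≡ tailWeightAll
    Θ-sum 1≤t = begin
        q' * sumFromTo 1 t (λ i → nᵢ i * Θ q i) + tailSize
          ≡⟨ cong (λ z → q' * z + tailSize) byMembers ⟩
        q' * ∑P (λ i → inTail i * (1 * Θ q (k i))) + tailSize
          ≡⟨ cong (_+ tailSize) (sym (∑-*ˡ (List.allFin N) q' _)) ⟩
        ∑P (λ i → q' * (inTail i * (1 * Θ q (k i)))) + ∑P inTail
          ≡⟨ sym (∑-+ (List.allFin N) _ _) ⟩
        ∑P (λ i → q' * (inTail i * (1 * Θ q (k i))) + inTail i)
          ≡⟨ ∑-cong (List.allFin N) (λ i → trans (factor q' (inTail i) (Θ q (k i))) (cong (inTail i *_) (Θ-identity (k i)))) ⟩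
        tailWeightAll ∎
      where
        open ≡-Reasoning
        range : List ℕ
        range = List.upTo (suc t ∸ 1)
        factor : ∀ Q w T → Q * (w * (1 * T)) + w ≡ w * (Q * T + 1)
        factor = solve-∀
        byMembers : sumFromTo 1 t (λ i → nᵢ i * Θ q i) ≡ ∑P (λ i → inTail i * (1 * Θ q (k i)))
        byMembers = trans (sum-map≡∑ _ range)
          (trans (∑-cong range (λ j → cong (_* Θ q (1 + j)) (trans (count≡∑P _) (∑-cong (List.allFin N) (λ i → sym (ℕP.*-identityʳ _))))))
                 (∑-byDimension 1 (λ _ → 1) (Θ q) (λ i → proj₁ isP i) 1≤t))

module MainArgument (F : FiniteField) (n' : ℕ) (P : List (VectorSpace.Subspace F (suc n')))
                    (isP : VectorSpace.IsSubspacePartition F (suc n') P) where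
  open FiniteField F using (0#) renaming (_≟_ to _≟F_)
  open FieldVectors F
  open Hyperplanes F n' using (n; kernelHyperplane; hyperplaneFunctional)
  open VectorSpace F n
  open Spans F n
  open PartitionSums F n P isP
  open Translation F n P isP
  open Partition F n P using (nᵢ; supertailSize; β)
  open EnumerationProperties (vecEnumeration n) using (split)

  nz : V → ℕ
  nz a = 𝟙 (not (does (a ≟v 0v)))

  nonzero-witness : (h g : V → ℕ) → ∑V n (λ a → nz a * h a) < ∑V n (λ a → nz a * g a) →
    ∃ λ a → ¬ a ≡ 0v × h a < g a
  nonzero-witness h g lt with ∑-<-witness (allV n) _ _ lt
  ... | a , lt' = a , not-does (a ≟v 0v) (proj₁ smaller) , proj₂ smaller
    where
      smaller : not (does (a ≟v 0v)) ≡ true × h a < g a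
      smaller = 𝟙-*-< (not (does (a ≟v 0v))) (h a) (g a) lt'

  module WithSupertail (d t : ℕ) (i₀ : Fin N) (k₀≡t : k i₀ ≡ t) (t<d : t < d)
           (tail≤t : ∀ i → k i < d → k i ≤ t) (|ST| : supertailSize d ≡ q ^ t + 1) where
    open Supertail d t tail≤t t<d

    D : ℕ
    D = q ^ d

    Q : ℕ
    Q = q ^ t

    inTail₀ : inTail i₀ ≡ 1
    inTail₀ = cong 𝟙 (does-yes (suc (k i₀) ℕ.≤? d) (subst (_< d) (sym k₀≡t) t<d))

    tailSize≡ : tailSize ≡ Q + 1
    tailSize≡ = trans (sym supertailSize≡tailSize) |ST|

    q^k₀≡Q : q ^ k i₀ ≡ Q
    q^k₀≡Q = cong (q ^_) k₀≡t

    -- Outside the supertail dim S ≥ d, so q^(dim S) = q^d · q^(dim S - d):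
    -- every hyperplane weight splits into its supertail part plus a multiple of q^d.
    headQuot : Fin N → ℕ
    headQuot i = 𝟙 (not (inTailᵇ i)) * q ^ (k i ∸ d)

    split-power : ∀ i c → c * q ^ k i ≡ c * (inTail i * q ^ k i) + D * (c * headQuot i)
    split-power i c = byCase (suc (k i) ℕ.≤? d)
      where
        byCase : (k<d? : Dec (suc (k i) ≤ d)) →
          c * q ^ k i ≡ c * (𝟙 (does k<d?) * q ^ k i) + D * (c * (𝟙 (not (does k<d?)) * q ^ (k i ∸ d)))
        byCase (yes _)   = inTail-case c (q ^ k i) D
          where
            inTail-case : ∀ c x D → c * x ≡ c * (1 * x) + D * (c * 0)
            inTail-case = solve-∀
        byCase (no k≮d) = trans (cong (c *_) q^k≡D*q^rest) (head-case c D (q ^ (k i ∸ d)))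
          where
            q^k≡D*q^rest : q ^ k i ≡ D * q ^ (k i ∸ d)
            q^k≡D*q^rest = trans (cong (q ^_) (sym (ℕP.m+[n∸m]≡n (ℕP.≤-pred (ℕP.≰⇒> k≮d))))) (ℕP.^-distribˡ-+-* q d (k i ∸ d))
            head-case : ∀ c D x → c * (D * x) ≡ c * 0 + D * (c * (1 * x))
            head-case = solve-∀

    headWeight : V → ℕ
    headWeight a = ∑P (λ i → inH i a * headQuot i)

    headWeightAll : ℕ
    headWeightAll = ∑P headQuot

    hyperplaneWeight-split : ∀ a → hyperplaneWeight a ≡ tailWeight a + D * headWeight a
    hyperplaneWeight-split a = trans (∑-cong (List.allFin N) (λ i → split-power i (inH i a)))
      (trans (∑-+ (List.allFin N) _ _) (cong (tailWeight a +_) (∑-*ˡ (List.allFin N) D _)))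

    ∑q^k-split : ∑q^k ≡ tailWeightAll + D * headWeightAll
    ∑q^k-split = trans (∑-cong (List.allFin N) (λ i → trans (sym (ℕP.*-identityˡ _))
                   (trans (split-power i 1) (cong₂ _+_ (ℕP.*-identityˡ _) (cong (D *_) (ℕP.*-identityˡ _))))))
      (trans (∑-+ (List.allFin N) _ _) (cong (tailWeightAll +_) (∑-*ˡ (List.allFin N) D _)))

    -- the key congruence: tailWeight a ≡ |P| - 1 (mod q^d) for every a ≠ 0
    tail-congruence : ∀ a → ¬ a ≡ 0v → tailWeight a + D * headWeight a + 1 ≡ N
    tail-congruence a a≢0 = trans (cong (_+ 1) (sym (hyperplaneWeight-split a))) (hyperplaneWeight+1≡N a a≢0)

    congruent : ∀ a a' → ¬ a ≡ 0v → ¬ a' ≡ 0v → tailWeight a + D * headWeight a ≡ tailWeight a' + D * headWeight a'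
    congruent a a' a≢0 a'≢0 = ℕP.+-cancelʳ-≡ 1 _ _ (trans (tail-congruence a a≢0) (sym (tail-congruence a' a'≢0)))

    residue≤ : ∀ x y u v → x + D * u ≡ y + D * v → y < D → y ≤ x
    residue≤ x y u v e y<D = subst (_≤ x) x%D≡y (m%n≤m x D)
      where
        instance
          D≢0 : NonZero D
          D≢0 = q^≢0 d
        x%D≡y : x % D ≡ y
        x%D≡y = begin
          x % D                ≡⟨ sym ([m+kn]%n≡m%n x u D) ⟩
          (x + u * D) % D      ≡⟨ cong (λ z → (x + z) % D) (ℕP.*-comm u D) ⟩
          (x + D * u) % D      ≡⟨ cong (_% D) e ⟩
          (y + D * v) % D      ≡⟨ cong (λ z → (y + z) % D) (ℕP.*-comm D v) ⟩
          (y + v * D) % D      ≡⟨ [m+kn]%n≡m%n y v D ⟩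
          y % D                ≡⟨ m<n⇒m%n≡m y<D ⟩
          y                    ∎
          where open ≡-Reasoning

    tailWeight-zero : tailWeight 0v ≡ tailWeightAll
    tailWeight-zero = ∑-cong (List.allFin N) (λ i → trans (cong (_* (inTail i * q ^ k i)) (inH-zero i)) (ℕP.*-identityˡ _))

    -- each member S lies in q^(n - dim S) of the a^⊥, so Σ_a tailWeight a = |ST| q^n
    ∑-tailWeight : ∑V n tailWeight ≡ tailSize * q ^ n
    ∑-tailWeight = begin
        ∑V n tailWeight                                           ≡⟨ ∑-cong (allV n) (λ a → sym (ℕP.*-identityˡ _)) ⟩
        ∑V n (λ a → 1 * tailWeight a)                             ≡⟨ ∑-average (λ _ → 1) (λ i → inTail i * q ^ k i) ⟩
        ∑P (λ i → ∑V n (λ a → 1 * inH i a) * (inTail i * q ^ k i)) ≡⟨ ∑-cong (List.allFin N) perMember ⟩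
        ∑P (λ i → inTail i * q ^ n)                               ≡⟨ ∑-*ʳ (List.allFin N) (q ^ n) inTail ⟩
        tailSize * q ^ n                                          ∎
      where
        open ≡-Reasoning
        rearrange : ∀ W w K → W * (w * K) ≡ w * (W * K)
        rearrange = solve-∀
        perMember : ∀ i → ∑V n (λ a → 1 * inH i a) * (inTail i * q ^ k i) ≡ inTail i * q ^ n
        perMember i = trans (cong (_* (inTail i * q ^ k i)) (∑-cong (allV n) (λ a → ℕP.*-identityˡ (inH i a))))
                            (trans (rearrange (annSize (B i)) (inTail i) _) (cong (inTail i *_) (annSize-indep (B i) (indep (member i)))))

    others : Fin N → ℕ
    others i = 𝟙 (not (does (i Fin.≟ i₀)))

    split₀ : (g : Fin N → ℕ) → ∑P g ≡ g i₀ + ∑P (λ i → others i * g i)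
    split₀ = EnumerationProperties.split (finEnumeration N) i₀

    otherTail≡Q : ∑P (λ i → others i * inTail i) ≡ Q
    otherTail≡Q = ℕP.+-cancelˡ-≡ 1 _ _ (begin
        1 + ∑P (λ i → others i * inTail i)       ≡⟨ cong (_+ ∑P (λ i → others i * inTail i)) (sym inTail₀) ⟩
        inTail i₀ + ∑P (λ i → others i * inTail i) ≡⟨ sym (split₀ inTail) ⟩
        tailSize                                 ≡⟨ tailSize≡ ⟩
        Q + 1                                    ≡⟨ ℕP.+-comm Q 1 ⟩
        1 + Q                                    ∎)
      where open ≡-Reasoning

    joint : Fin N → ℕ
    joint i = ∑V n (λ a → inH i₀ a * inH i a)

    -- S₀ lies in q^(n-t) of the a^⊥ and has q^t vectors
    S₀-contribution : joint i₀ * (inTail i₀ * q ^ k i₀) ≡ q ^ n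
    S₀-contribution = begin
        joint i₀ * (inTail i₀ * q ^ k i₀) ≡⟨ cong₂ (λ x y → x * (y * q ^ k i₀)) (∑-cong (allV n) (λ a → 𝟙-idem _)) inTail₀ ⟩
        annSize (B i₀) * (1 * q ^ k i₀)  ≡⟨ cong (annSize (B i₀) *_) (ℕP.*-identityˡ _) ⟩
        annSize (B i₀) * q ^ k i₀        ≡⟨ annSize-indep (B i₀) (indep (member i₀)) ⟩
        q ^ n                            ∎
      where open ≡-Reasoning

    -- another supertail member S lies together with S₀ in q^(n - t - dim S) of the a^⊥
    other-contribution : ∀ i → Q * (others i * (joint i * (inTail i * q ^ k i))) ≡ others i * (inTail i * q ^ n)
    other-contribution i = byCase (i Fin.≟ i₀)
      where
        rearrange : ∀ Q W w K → Q * (1 * (W * (w * K))) ≡ 1 * (w * (W * (Q * K)))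
        rearrange = solve-∀
        byCase : (i≟i₀ : Dec (i ≡ i₀)) →
          Q * (𝟙 (not (does i≟i₀)) * (joint i * (inTail i * q ^ k i))) ≡ 𝟙 (not (does i≟i₀)) * (inTail i * q ^ n)
        byCase (yes _)   = ℕP.*-zeroʳ Q
        byCase (no i≢i₀) = trans (rearrange Q (joint i) (inTail i) (q ^ k i)) (cong (λ z → 1 * (inTail i * z)) pair)
          where
            pair : joint i * (Q * q ^ k i) ≡ q ^ n
            pair = trans (cong (λ x → joint i * (x * q ^ k i)) (sym q^k₀≡Q)) (inH-pair i₀ i (λ e → i≢i₀ (sym e)))

    -- hence the hyperplanes through S₀ have tail weights summing to
    -- q^n (from S₀) + q^t · q^(n-t) (from the q^t other supertail members)
    ∑-tailWeight-through₀ : ∑V n (λ a → inH i₀ a * tailWeight a) ≡ 2 * q ^ n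
    ∑-tailWeight-through₀ = ℕP.*-cancelˡ-≡ _ _ Q {{q^≢0 t}} (begin
        Q * ∑V n (λ a → inH i₀ a * tailWeight a)
          ≡⟨ cong (Q *_) (trans (∑-average (inH i₀) f) (split₀ _)) ⟩
        Q * (joint i₀ * f i₀ + ∑P (λ i → others i * (joint i * f i)))
          ≡⟨ ℕP.*-distribˡ-+ Q _ _ ⟩
        Q * (joint i₀ * f i₀) + Q * ∑P (λ i → others i * (joint i * f i))
          ≡⟨ cong₂ _+_ (cong (Q *_) S₀-contribution) (trans (sym (∑-*ˡ (List.allFin N) Q _)) (∑-cong (List.allFin N) other-contribution)) ⟩
        Q * q ^ n + ∑P (λ i → others i * (inTail i * q ^ n))
          ≡⟨ cong (Q * q ^ n +_) (trans (∑-cong (List.allFin N) (λ i → sym (ℕP.*-assoc (others i) (inTail i) _)))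
                                        (trans (∑-*ʳ (List.allFin N) (q ^ n) _) (cong (_* q ^ n) otherTail≡Q))) ⟩
        Q * q ^ n + Q * q ^ n
          ≡⟨ double Q (q ^ n) ⟩
        Q * (2 * q ^ n) ∎)
      where
        open ≡-Reasoning
        f : Fin N → ℕ
        f i = inTail i * q ^ k i
        double : ∀ x y → x * y + x * y ≡ x * (2 * y)
        double = solve-∀

    -- size estimates: members have at least q ≥ 2 vectors, and q^d ≥ q·q^t
    q^k≥2 : ∀ i → 2 ≤ q ^ k i
    q^k≥2 i = ℕP.≤-trans q≥2 (ℕP.≤-trans (ℕP.≤-reflexive (sym (ℕP.*-identityʳ q))) (ℕP.^-monoʳ-≤ q (proj₁ isP i)))

    tailSize<tailWeightAll : tailSize < tailWeightAll
    tailSize<tailWeightAll = ℕP.<-≤-trans (ℕP.m<m+n tailSize 0<tailSize) (subst (_≤ tailWeightAll) double twice≤)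
      where
        0<tailSize : 0 < tailSize + 0
        0<tailSize = subst (0 <_) (trans (ℕP.+-comm 1 Q) (trans (sym tailSize≡) (sym (ℕP.+-identityʳ _)))) (s≤s z≤n)
        double : 2 * tailSize ≡ tailSize + (tailSize + 0)
        double = refl
        twice≤ : 2 * tailSize ≤ tailWeightAll
        twice≤ = subst (_≤ tailWeightAll) (∑-*ˡ (List.allFin N) 2 inTail)
          (∑-mono (List.allFin N) (λ i → subst (_≤ inTail i * q ^ k i) (ℕP.*-comm (inTail i) 2) (ℕP.*-monoʳ-≤ (inTail i) (q^k≥2 i))))

    3Q≤tailWeightAll : 3 * Q ≤ tailWeightAll
    3Q≤tailWeightAll = subst₂ _≤_ (three Q) (sym (split₀ (λ i → inTail i * q ^ k i)))
                              (ℕP.+-mono-≤ (ℕP.≤-reflexive (sym S₀-weight)) othersWeight)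
      where
        three : ∀ Q → Q + 2 * Q ≡ 3 * Q
        three = solve-∀
        S₀-weight : inTail i₀ * q ^ k i₀ ≡ Q
        S₀-weight = trans (cong (_* q ^ k i₀) inTail₀) (trans (ℕP.*-identityˡ _) q^k₀≡Q)
        swap : ∀ a b → a * (b * 2) ≡ 2 * (a * b)
        swap = solve-∀
        othersWeight : 2 * Q ≤ ∑P (λ i → others i * (inTail i * q ^ k i))
        othersWeight = subst (_≤ ∑P (λ i → others i * (inTail i * q ^ k i)))
          (trans (∑-cong (List.allFin N) (λ i → swap (others i) (inTail i))) (trans (∑-*ˡ (List.allFin N) 2 _) (cong (2 *_) otherTail≡Q)))
          (∑-mono (List.allFin N) (λ i → ℕP.*-monoʳ-≤ (others i) (ℕP.*-monoʳ-≤ (inTail i) (q^k≥2 i))))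

    2Q≤D : 2 * Q ≤ D
    2Q≤D = ℕP.≤-trans (ℕP.*-monoˡ-≤ Q q≥2) (ℕP.^-monoʳ-≤ q t<d)

    Q<D : Q < D
    Q<D = ℕP.^-monoʳ-< q q≥2 t<d

    cancel-< : ∀ {x a y b} → x + a ≡ y + b → y < x → a < b
    cancel-< {x} {a} {y} {b} e y<x = ℕP.+-cancelˡ-< x a b (subst (_< x + b) (sym e) (ℕP.+-monoˡ-< b y<x))

    -- Averaging over all a ≠ 0: Σ_{a≠0} tailWeight a = |ST| q^n - tailWeightAll is
    -- smaller than Σ_{a≠0} |ST|, so some hyperplane has tail weight below |ST| = q^t + 1.
    light-hyperplane : ∃ λ a → ¬ a ≡ 0v × tailWeight a < tailSize
    light-hyperplane = nonzero-witness tailWeight (λ _ → tailSize) (cancel-< (trans weights (sym sizes)) tailSize<tailWeightAll)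
      where
        weights : tailWeightAll + ∑V n (λ a → nz a * tailWeight a) ≡ tailSize * q ^ n
        weights = trans (cong (_+ ∑V n (λ a → nz a * tailWeight a)) (sym tailWeight-zero)) (trans (sym (split 0v tailWeight)) ∑-tailWeight)
        sizes : tailSize + ∑V n (λ a → nz a * tailSize) ≡ tailSize * q ^ n
        sizes = trans (sym (split 0v (λ _ → tailSize))) (trans (∑V-const n tailSize) (ℕP.*-comm (q ^ n) tailSize))

    -- Averaging over the a ≠ 0 with S₀ ⊆ a^⊥: their tail weights sum to
    -- 2 q^n - tailWeightAll < (|ann S₀| - 1) q^d.
    L₀ : ℕ
    L₀ = ∑V n (λ a → nz a * inH i₀ a)

    through₀-bound : ∑V n (λ a → nz a * (inH i₀ a * tailWeight a)) < ∑V n (λ a → nz a * (inH i₀ a * D))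
    through₀-bound = subst (Σweights <_) (sym ceilings)
      (ℕP.+-cancelʳ-< tailWeightAll Σweights (L₀ * D)
        (subst (_< L₀ * D + tailWeightAll) (trans (sym weights) (ℕP.+-comm tailWeightAll Σweights))
               (bound Q L₀ D tailWeightAll 2Q≤D 3Q≤tailWeightAll (ℕP.m^n>0 q t))))
      where
        Σweights : ℕ
        Σweights = ∑V n (λ a → nz a * (inH i₀ a * tailWeight a))
        bound : ∀ Q L D X → 2 * Q ≤ D → 3 * Q ≤ X → 1 ≤ Q → 2 * ((1 + L) * Q) < L * D + X
        bound Q L D X 2Q≤D 3Q≤X 1≤Q = begin-strict
            2 * ((1 + L) * Q)   ≡⟨ expand Q L ⟩
            L * (2 * Q) + 2 * Q <⟨ ℕP.+-monoʳ-< (L * (2 * Q)) (subst (2 * Q <_) (sym (three Q)) (ℕP.m<m+n (2 * Q) 1≤Q)) ⟩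
            L * (2 * Q) + 3 * Q ≤⟨ ℕP.+-mono-≤ (ℕP.*-monoʳ-≤ L 2Q≤D) 3Q≤X ⟩
            L * D + X           ∎
          where
            open ℕP.≤-Reasoning
            expand : ∀ Q L → 2 * ((1 + L) * Q) ≡ L * (2 * Q) + 2 * Q
            expand = solve-∀
            three : ∀ Q → 3 * Q ≡ 2 * Q + Q
            three = solve-∀
        annSize₀ : annSize (B i₀) ≡ 1 + L₀
        annSize₀ = trans (split 0v (inH i₀)) (cong (_+ L₀) (inH-zero i₀))
        weights : tailWeightAll + Σweights ≡ 2 * ((1 + L₀) * Q)
        weights = begin
            tailWeightAll + Σweights                   ≡⟨ cong (_+ Σweights) (trans (sym tailWeight-zero) (sym (ℕP.*-identityˡ _))) ⟩
            1 * tailWeight 0v + Σweights               ≡⟨ cong (λ z → z * tailWeight 0v + Σweights) (sym (inH-zero i₀)) ⟩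
            inH i₀ 0v * tailWeight 0v + Σweights       ≡⟨ sym (split 0v (λ a → inH i₀ a * tailWeight a)) ⟩
            ∑V n (λ a → inH i₀ a * tailWeight a)       ≡⟨ ∑-tailWeight-through₀ ⟩
            2 * q ^ n                                  ≡⟨ cong (2 *_) (sym (annSize-indep (B i₀) (indep (member i₀)))) ⟩
            2 * (annSize (B i₀) * q ^ k i₀)            ≡⟨ cong₂ (λ x y → 2 * (x * y)) annSize₀ q^k₀≡Q ⟩
            2 * ((1 + L₀) * Q)                         ∎
          where open ≡-Reasoning
        ceilings : ∑V n (λ a → nz a * (inH i₀ a * D)) ≡ L₀ * D
        ceilings = trans (∑-cong (allV n) (λ a → sym (ℕP.*-assoc (nz a) (inH i₀ a) D))) (∑-*ʳ (allV n) D _)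

    light-hyperplane-through₀ : ∃ λ a → ¬ a ≡ 0v × pairings (B i₀) a ≡ 0v × tailWeight a < D
    light-hyperplane-through₀ = a , a≢0 , does-true (pairings (B i₀) a ≟v 0v) (proj₁ below) , proj₂ below
      where
        found : ∃ λ a → ¬ a ≡ 0v × inH i₀ a * tailWeight a < inH i₀ a * D
        found = nonzero-witness (λ a → inH i₀ a * tailWeight a) (λ a → inH i₀ a * D) through₀-bound
        a : V
        a = proj₁ found
        a≢0 : ¬ a ≡ 0v
        a≢0 = proj₁ (proj₂ found)
        below : does (pairings (B i₀) a ≟v 0v) ≡ true × tailWeight a < D
        below = 𝟙-*-< (does (pairings (B i₀) a ≟v 0v)) (tailWeight a) D (proj₂ (proj₂ found))

    -- The two light hyperplanes are congruent mod q^d with residues below q^d, so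
    -- they have equal tail weight; the first has weight ≤ q^t, the second ≥ q^t as
    -- it contains S₀.  Every other a ≠ 0 is congruent to the first, hence ≥ q^t.
    a₁ : V
    a₁ = proj₁ light-hyperplane

    a₁≢0 : ¬ a₁ ≡ 0v
    a₁≢0 = proj₁ (proj₂ light-hyperplane)

    a₂ : V
    a₂ = proj₁ light-hyperplane-through₀

    Q≤tailWeight₂ : Q ≤ tailWeight a₂
    Q≤tailWeight₂ = subst (_≤ tailWeight a₂) S₀-term
      (EnumerationProperties.term≤∑ (finEnumeration N) (λ i → inH i a₂ * (inTail i * q ^ k i)) i₀)
      where
        S₀⊆a₂⊥ : inH i₀ a₂ ≡ 1
        S₀⊆a₂⊥ = cong 𝟙 (does-yes (pairings (B i₀) a₂ ≟v 0v) (proj₁ (proj₂ (proj₂ light-hyperplane-through₀))))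
        S₀-term : inH i₀ a₂ * (inTail i₀ * q ^ k i₀) ≡ Q
        S₀-term = trans (cong₂ (λ x y → x * (y * q ^ k i₀)) S₀⊆a₂⊥ inTail₀)
                        (trans (ℕP.*-identityˡ _) (trans (ℕP.*-identityˡ _) q^k₀≡Q))

    tailWeight₁≡Q : tailWeight a₁ ≡ Q
    tailWeight₁≡Q = ℕP.≤-antisym tailWeight₁≤Q (ℕP.≤-trans Q≤tailWeight₂
      (residue≤ (tailWeight a₁) (tailWeight a₂) (headWeight a₁) (headWeight a₂)
                (congruent a₁ a₂ a₁≢0 (proj₁ (proj₂ light-hyperplane-through₀)))
                (proj₂ (proj₂ (proj₂ light-hyperplane-through₀)))))
      where
        tailWeight₁≤Q : tailWeight a₁ ≤ Q
        tailWeight₁≤Q = ℕP.≤-pred (subst (tailWeight a₁ <_) (trans tailSize≡ (ℕP.+-comm Q 1)) (proj₂ (proj₂ light-hyperplane)))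

    Q≤tailWeight : ∀ a → ¬ a ≡ 0v → Q ≤ tailWeight a
    Q≤tailWeight a a≢0 = residue≤ (tailWeight a) Q (headWeight a) (headWeight a₁)
      (trans (congruent a a₁ a≢0 a₁≢0) (cong (_+ D * headWeight a₁) tailWeight₁≡Q)) Q<D

    β-minimum : (d₁ : ℕ) → (∀ i → d₁ ≤ k i) →
      (∃ λ (H : Subspace) → IsHyperplane H × β d₁ t H ≡ Q) × (∀ (H : Subspace) → IsHyperplane H → Q ≤ β d₁ t H)
    β-minimum d₁ d₁≤k = attained , bounded
      where
        d₁≤t : d₁ ≤ t
        d₁≤t = subst (d₁ ≤_) k₀≡t (d₁≤k i₀)
        attained : ∃ λ (H : Subspace) → IsHyperplane H × β d₁ t H ≡ Q
        attained = H₁ , proj₁ (proj₂ kernel₁) , trans (β≡tailWeight d₁ d₁≤k d₁≤t H₁ a₁ (proj₂ (proj₂ kernel₁))) tailWeight₁≡Q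
          where
            kernel₁ : ∃ λ (H : Subspace) → dim H ≡ n' × (∀ v → memberᵇ v H ≡ does (dot a₁ v ≟F 0#))
            kernel₁ = kernelHyperplane a₁ a₁≢0
            H₁ : Subspace
            H₁ = proj₁ kernel₁
        bounded : ∀ (H : Subspace) → IsHyperplane H → Q ≤ β d₁ t H
        bounded H dimH = subst (Q ≤_) (sym (β≡tailWeight d₁ d₁≤k d₁≤t H a (proj₂ (proj₂ functional)))) (Q≤tailWeight a (proj₁ (proj₂ functional)))
          where
            functional : ∃ λ a → ¬ a ≡ 0v × (∀ v → memberᵇ v H ≡ does (dot a v ≟F 0#))
            functional = hyperplaneFunctional H dimH
            a : V
            a = proj₁ functional

    Z : ℕ
    Z = q' * sumFromTo 1 t (λ i → nᵢ i * Θ q i)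

    -- evaluating the congruence at a₁ (where tailWeight = q^t) and comparing with
    -- card-identity:  Z + 1 + q^d·headWeightAll = q^d (headWeight a₁ + q^(n-d))

    Θ-count : d ≤ n → Z + 1 + D * headWeightAll ≡ D * headWeight a₁ + D * q ^ (n ∸ d)
    Θ-count d≤n = trans (cancel Z Q (D * headWeightAll) (D * headWeight a₁) (q ^ n) counted) (cong (D * headWeight a₁ +_) q^n≡)
      where
        open ≡-Reasoning
        1≤t : 1 ≤ t
        1≤t = subst (1 ≤_) k₀≡t (proj₁ isP i₀)
        counted : Z + (Q + 1) + D * headWeightAll + 1 ≡ Q + D * headWeight a₁ + 1 + q ^ n
        counted = begin
          Z + (Q + 1) + D * headWeightAll + 1           ≡⟨ cong (λ z → Z + z + D * headWeightAll + 1) (sym tailSize≡) ⟩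
          Z + tailSize + D * headWeightAll + 1          ≡⟨ cong (λ z → z + D * headWeightAll + 1) (Θ-sum 1≤t) ⟩
          tailWeightAll + D * headWeightAll + 1         ≡⟨ cong (_+ 1) (sym ∑q^k-split) ⟩
          ∑q^k + 1                                      ≡⟨ card-identity ⟩
          N + q ^ n                                     ≡⟨ cong (_+ q ^ n) (sym (tail-congruence a₁ a₁≢0)) ⟩
          tailWeight a₁ + D * headWeight a₁ + 1 + q ^ n ≡⟨ cong (λ z → z + D * headWeight a₁ + 1 + q ^ n) tailWeight₁≡Q ⟩
          Q + D * headWeight a₁ + 1 + q ^ n             ∎
        q^n≡ : q ^ n ≡ D * q ^ (n ∸ d)
        q^n≡ = trans (cong (q ^_) (sym (ℕP.m+[n∸m]≡n d≤n))) (ℕP.^-distribˡ-+-* q d (n ∸ d))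
        cancel : ∀ Z T Dm Dn Qn → Z + (T + 1) + Dm + 1 ≡ T + Dn + 1 + Qn → Z + 1 + Dm ≡ Dn + Qn
        cancel Z T Dm Dn Qn e = ℕP.+-cancelˡ-≡ (T + 1) _ _ (trans (l₁ Z T Dm) (trans e (l₂ T Dn Qn)))
          where
            l₁ : ∀ Z T Dm → T + 1 + (Z + 1 + Dm) ≡ Z + (T + 1) + Dm + 1
            l₁ = solve-∀
            l₂ : ∀ T Dn Qn → T + Dn + 1 + Qn ≡ T + 1 + (Dn + Qn)
            l₂ = solve-∀

    Θ-congruence : d ≤ n → ∃ λ (c₀ : ℤ) → ℤ.+ Z ℤ.+ ℤ.+ 1 ≡ c₀ ℤ.* ℤ.+ D
    Θ-congruence d≤n = ℤ.+ headWeight a₁ ℤ.+ ℤ.+ q ^ (n ∸ d) ℤ.- ℤ.+ headWeightAll ,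
      multiple-of (ℤ.+ Z ℤ.+ ℤ.+ 1) (ℤ.+ headWeightAll) (ℤ.+ headWeight a₁) (ℤ.+ q ^ (n ∸ d)) (ℤ.+ D) (begin
        ℤ.+ Z ℤ.+ ℤ.+ 1 ℤ.+ ℤ.+ D ℤ.* ℤ.+ headWeightAll
          ≡⟨ sym (trans (ℤP.pos-+ (Z + 1) (D * headWeightAll)) (cong₂ ℤ._+_ (ℤP.pos-+ Z 1) (ℤP.pos-* D headWeightAll))) ⟩
        ℤ.+ (Z + 1 + D * headWeightAll)
          ≡⟨ cong ℤ.+_ (Θ-count d≤n) ⟩
        ℤ.+ (D * headWeight a₁ + D * q ^ (n ∸ d))
          ≡⟨ trans (ℤP.pos-+ (D * headWeight a₁) _) (cong₂ ℤ._+_ (ℤP.pos-* D (headWeight a₁)) (ℤP.pos-* D _)) ⟩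
        ℤ.+ D ℤ.* ℤ.+ headWeight a₁ ℤ.+ ℤ.+ D ℤ.* ℤ.+ q ^ (n ∸ d) ∎)
      where
        open ≡-Reasoning
        multiple-of : ∀ (z u v w D : ℤ) → z ℤ.+ D ℤ.* u ≡ D ℤ.* v ℤ.+ D ℤ.* w → z ≡ (v ℤ.+ w ℤ.- u) ℤ.* D
        multiple-of z u v w D e = trans (l₁ z D u) (trans (cong (ℤ._- D ℤ.* u) e) (l₂ D u v w))
          where
            l₁ : ∀ z D u → z ≡ (z ℤ.+ D ℤ.* u) ℤ.- D ℤ.* u
            l₁ = ℤSolver.solve-∀
            l₂ : ∀ D u v w → (D ℤ.* v ℤ.+ D ℤ.* w) ℤ.- D ℤ.* u ≡ (v ℤ.+ w ℤ.- u) ℤ.* D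
            l₂ = ℤSolver.solve-∀

zeroSpace-trivial : (F : FiniteField) (U : VectorSpace.Subspace F 0) → 1 ≤ VectorSpace.dim U → ⊥
zeroSpace-trivial F (VectorSpace.subspace (suc j) (b ∷ C) indepU) _ =
  FiniteField.0≢1 F (sym (VecP.∷-injectiveˡ (indepU (FiniteField.1# F ∷ replicate j (FiniteField.0# F)) (empty _))))
  where
    empty : (u : Vec (FiniteField.Carrier F) 0) → u ≡ []
    empty [] = refl

lemma7 : (F : FiniteField) (n : ℕ) (P : List (VectorSpace.Subspace F n)) →
  let open VectorSpace F n
      open Partition F n P
  in IsSubspacePartition P →
     (d₁ dₘ d t : ℕ) →
     -- d₁ is the smallest and dₘ the largest dimension occurring in P
     (∃ λ (i : Fin (length P)) → dim (lookup P i) ≡ d₁) →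
     (∀ (i : Fin (length P)) → d₁ ≤ dim (lookup P i)) →
     (∃ λ (i : Fin (length P)) → dim (lookup P i) ≡ dₘ) →
     (∀ (i : Fin (length P)) → dim (lookup P i) ≤ dₘ) →
     d₁ < d → d ≤ dₘ →
     -- t is the maximum dimension of a subspace in the d-supertail
     (∃ λ (i : Fin (length P)) → dim (lookup P i) ≡ t × t < d) →
     (∀ (i : Fin (length P)) → dim (lookup P i) < d → dim (lookup P i) ≤ t) →
     d < 2 * t →
     supertailSize d ≡ q ^ t + 1 →
     -- β₀ = min_H β_H = q^t
     ((∃ λ (H : Subspace) → IsHyperplane H × β d₁ t H ≡ q ^ t)
      × (∀ (H : Subspace) → IsHyperplane H → q ^ t ≤ β d₁ t H))
     -- Σ_{i=1}^t n_i Θ_i = (c₀ q^d - 1)/(q - 1)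
     × (∃ λ (c₀ : ℤ) →
          ℤ.+ ((q ∸ 1) * sumFromTo 1 t (λ i → nᵢ i * Θ q i)) ℤ.+ ℤ.+ 1
            ≡ c₀ ℤ.* ℤ.+ (q ^ d))
lemma7 F zero P isP d₁ dₘ d t _ _ _ _ _ _ (i₀ , _) _ _ _ =
  ⊥-elim (zeroSpace-trivial F (lookup P i₀) (proj₁ isP i₀))
lemma7 F (suc n') P isP d₁ dₘ d t _ d₁≤k (iₘ , kₘ≡dₘ) _ _ d≤dₘ (i₀ , k₀≡t , t<d) tail≤t _ |ST| =
  β-minimum d₁ d₁≤k , Θ-congruence d≤n
  where
    open VectorSpace F (suc n') using (basis; indep)
    open MainArgument.WithSupertail F n' P isP d t i₀ k₀≡t t<d tail≤t |ST|
    -- d ≤ dₘ ≤ n, the largest member being spanned by dₘ independent vectors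
    d≤n : d ≤ suc n'
    d≤n = ℕP.≤-trans d≤dₘ (subst (_≤ suc n') kₘ≡dₘ
            (Spans.indep-length≤n F (suc n') (basis (lookup P iₘ)) (indep (lookup P iₘ))))
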